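{- Let $\forall U\exists E\,\phi$ be an S-form DQBF with CNF matrix $\phi$. Let $l$ be a literal of an existential variable in $E$ and let $C$ be a clause not in $\phi$ with $l\in C$. Suppose that every clause $D\in\phi$ with $\bar l\in D$ satisfies $\phi\wedge\bar C\wedge\bar O_D\wedge\bar l\vdash_1\bot$. Then, using a number of D-Frege+$\forall$red rule applications polynomially bounded in the size of $\forall U\exists E\,\phi$, one can extend $E$ to $E'$ containing a new existential variable $l'$ with $D_{l'}\subseteq D_{\mathrm{var}(l)}$ and derive all clauses of $(\phi\wedge C)'$, the copy of $\phi\wedge C$ in which every occurrence of $l$ is replaced by $l'$ and every occurrence of $\bar l$ by $\bar l'$.
   Context: An S-form DQBF is a formula $\forall U\exists E\,\phi$ where $U$ is a finite set of universal variables, $E$ a finite set of existential variables, each $x\in E$ carries a dependency set $D_x\subseteq U$, and $\phi$ is a quantifier-free propositional formula over $U\cup E$. For a universal variable $u$ set $D_u=\{u\}$. D-Frege+$\forall$red: derivations are sequences of propositional formulas, each obtained by one of: (Frege) an axiom or rule of a fixed Frege system applied to earlier lines; (Axiom) a conjunct of $\phi$; (IndExt) a formula $\alpha\to(v\leftrightarrow\bigwedge_{y\in Y}y)$ or $\alpha\to(v\leftrightarrow\bigvee_{y\in Y}y)$, where $\alpha$ is a conjunction of universal literals, $Y$ a set of literals of existing variables, and $v$ a fresh variable added as existential with $D_v=(\bigcup_{y\in Y}D_{\mathrm{var}(y)})\setminus\mathrm{var}(\alpha)$; ($\forall$-red) from an earlier line $L(u)$ derive $L(0)$ or $L(1)$,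 where $u$ is universal and no existential variable $x$ occurring in $L$ has $u\in D_x$; (prefix weakening) the prefix may be extended by a new variable not occurring in the matrix. Outer clause with respect to the existential literal $l$: for a clause $D$, $O_D=\{x\in D\mid \mathrm{var}(x)\in E,\ D_{\mathrm{var}(x)}\subseteq D_{\mathrm{var}(l)},\ \mathrm{var}(x)\ne\mathrm{var}(l)\}\cup\{x\in D\mid \mathrm{var}(x)\in U,\ \mathrm{var}(x)\in D_{\mathrm{var}(l)}\}$. For a clause $K$, $\bar K$ denotes the conjunction of the unit clauses $\{\bar k\}$, $k\in K$. For a CNF $\psi$, $\psi\vdash_1\bot$ means unit propagation derives the empty clause: repeatedly, for each unit clause $\{k\}$ assign $k$ true and delete the literal $\bar k$ from all clauses, until the empty clause appears. -}

module Defs where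

open import Data.Nat using (ℕ; zero; suc; _+_; _*_; _^_; _≤_; _≟_)
open import Data.Bool using (Bool; true; false; if_then_else_; not; _∧_; _∨_)
open import Data.List using (List; []; _∷_; _++_; map; foldr; length; concatMap)
open import Data.Nat.ListAction using (sum)
open import Data.List.Membership.Propositional using (_∈_; _∉_)
open import Data.List.Relation.Unary.All using (All)
open import Data.List.Relation.Unary.Unique.Propositional using (Unique)
open import Data.Product using (Σ; ∃; _×_; _,_)
open import Data.Sum using (_⊎_)
open import Relation.Nullary using (¬_; does)
open import Relation.Binary.PropositionalEquality using (_≡_)

data Lit : Set where
  pos : ℕ → Lit
  neg : ℕ → Lit

var : Lit → ℕ
var (pos x) = x
var (neg x) = x

compl : Lit → Lit
compl (pos x) = neg x
compl (neg x) = pos x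

eqLit : Lit → Lit → Bool
eqLit (pos x) (pos y) = does (x ≟ y)
eqLit (neg x) (neg y) = does (x ≟ y)
eqLit _ _ = false

Clause : Set
Clause = List Lit

CNF : Set
CNF = List Clause

filterB : {A : Set} → (A → Bool) → List A → List A
filterB p [] = []
filterB p (x ∷ xs) = if p x then x ∷ filterB p xs else filterB p xs

memb : ℕ → List ℕ → Bool
memb x [] = false
memb x (y ∷ ys) = does (x ≟ y) ∨ memb x ys

subsetB : List ℕ → List ℕ → Bool
subsetB [] ys = true
subsetB (x ∷ xs) ys = memb x ys ∧ subsetB xs ys

_⊆_ : List ℕ → List ℕ → Set
xs ⊆ ys = ∀ {x} → x ∈ xs → x ∈ ys

_⊆ᶜ_ : Clause → Clause → Set
xs ⊆ᶜ ys = ∀ {x} → x ∈ xs → x ∈ ys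

data Form : Set where
  v    : ℕ → Form
  ⊤'   : Form
  ⊥'   : Form
  ¬'_  : Form → Form
  _∧'_ : Form → Form → Form
  _∨'_ : Form → Form → Form
  _⇒_  : Form → Form → Form

infixr 6 _∧'_
infixr 5 _∨'_
infixr 4 _⇒_

_⇔_ : Form → Form → Form
A ⇔ B = (A ⇒ B) ∧' (B ⇒ A)

litF : Lit → Form
litF (pos x) = v x
litF (neg x) = ¬' v x

clauseF : Clause → Form
clauseF = foldr (λ k F → litF k ∨' F) ⊥'

conjF : List Lit → Form
conjF = foldr (λ k F → litF k ∧' F) ⊤'

disjF : List Lit → Form
disjF = clauseF

data Occ (x : ℕ) : Form → Set where
  here : Occ x (v x)
  neg  : ∀ {A} → Occ x A → Occ x (¬' A)
  andL : ∀ {A B} → Occ x A → Occ x (A ∧' B)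
  andR : ∀ {A B} → Occ x B → Occ x (A ∧' B)
  orL  : ∀ {A B} → Occ x A → Occ x (A ∨' B)
  orR  : ∀ {A B} → Occ x B → Occ x (A ∨' B)
  impL : ∀ {A B} → Occ x A → Occ x (A ⇒ B)
  impR : ∀ {A B} → Occ x B → Occ x (A ⇒ B)

subst : ℕ → Form → Form → Form
subst u G (v x) = if does (x ≟ u) then G else v x
subst u G ⊤' = ⊤'
subst u G ⊥' = ⊥'
subst u G (¬' A) = ¬' subst u G A
subst u G (A ∧' B) = subst u G A ∧' subst u G B
subst u G (A ∨' B) = subst u G A ∨' subst u G B
subst u G (A ⇒ B) = subst u G A ⇒ subst u G B

data FregeAxiom : Form → Set where
  ax1  : ∀ A B → FregeAxiom (A ⇒ (B ⇒ A))
  ax2  : ∀ A B C → FregeAxiom ((A ⇒ B) ⇒ ((A ⇒ (B ⇒ C)) ⇒ (A ⇒ C)))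
  ax3  : ∀ A B → FregeAxiom (A ⇒ (B ⇒ (A ∧' B)))
  ax4  : ∀ A B → FregeAxiom ((A ∧' B) ⇒ A)
  ax5  : ∀ A B → FregeAxiom ((A ∧' B) ⇒ B)
  ax6  : ∀ A B → FregeAxiom (A ⇒ (A ∨' B))
  ax7  : ∀ A B → FregeAxiom (B ⇒ (A ∨' B))
  ax8  : ∀ A B C → FregeAxiom ((A ⇒ C) ⇒ ((B ⇒ C) ⇒ ((A ∨' B) ⇒ C)))
  ax9  : ∀ A B → FregeAxiom ((A ⇒ B) ⇒ ((A ⇒ ¬' B) ⇒ ¬' A))
  ax10 : ∀ A → FregeAxiom ((¬' (¬' A)) ⇒ A)
  ax11 : FregeAxiom ⊤'
  ax12 : ∀ A → FregeAxiom (⊥' ⇒ A)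

-- DQBF prefixes.  A prefix: universal variables U, existential
-- variables E, and dependency sets dep x (meaningful for x ∈ E).

record Prefix : Set where
  constructor mkPrefix
  field
    U   : List ℕ
    E   : List ℕ
    dep : ℕ → List ℕ
open Prefix public

depOf : Prefix → ℕ → List ℕ
depOf P w = if memb w (U P) then w ∷ [] else dep P w

record DQBF : Set where
  constructor mkDQBF
  field
    prefix : Prefix
    matrix : CNF
open DQBF public

matrixVars : CNF → List ℕ
matrixVars φ = concatMap (map var) φ

record SForm (Φ : DQBF) : Set where
  field
    uniqU    : Unique (U (prefix Φ))
    uniqE    : Unique (E (prefix Φ))
    disjoint : ∀ {x} → x ∈ U (prefix Φ) → x ∉ E (prefix Φ)
    depsU    : ∀ {x} → x ∈ E (prefix Φ) → dep (prefix Φ) x ⊆ U (prefix Φ)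
    closed   : ∀ {x} → x ∈ matrixVars (matrix Φ) → x ∈ (U (prefix Φ) ++ E (prefix Φ))

size : DQBF → ℕ
size Φ = length (U P) + length (E P)
       + sum (map (λ x → length (dep P x)) (E P))
       + sum (map (λ c → suc (length c)) (matrix Φ))
  where P = prefix Φ

outer : Prefix → Lit → Clause → Clause
outer P l D = filterB keepB D
  where
    keepB : Lit → Bool
    keepB x = (memb (var x) (E P) ∧ subsetB (dep P (var x)) (dep P (var l))
                 ∧ not (does (var x ≟ var l)))
              ∨ (memb (var x) (U P) ∧ memb (var x) (dep P (var l)))

negUnits : Clause → CNF
negUnits K = map (λ k → compl k ∷ []) K

data UP⊥ : CNF → Set where
  empty : ∀ {ψ} → [] ∈ ψ → UP⊥ ψ
  unit  : ∀ {ψ} k → (k ∷ []) ∈ ψ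
        → UP⊥ (map (filterB (λ m → not (eqLit m (compl k)))) ψ)
        → UP⊥ ψ

record State : Set where
  constructor ⟨_,_⟩
  field
    pre   : Prefix
    lines : List Form
open State public

Fresh : CNF → State → ℕ → Set
Fresh φ S w = (w ∉ U (pre S)) × (w ∉ E (pre S)) × (w ∉ matrixVars φ)
            × (∀ {F} → F ∈ lines S → ¬ Occ w F)

addE : Prefix → ℕ → List ℕ → Prefix
addE P w D = mkPrefix (U P) (E P ++ (w ∷ [])) (λ z → if does (z ≟ w) then D else dep P z)

addU : Prefix → ℕ → Prefix
addU P w = mkPrefix (U P ++ (w ∷ [])) (E P) (dep P)

indDep : Prefix → List Lit → List Lit → List ℕ
indDep P α Y = filterB (λ z → not (memb z (map var α))) (concatMap (λ y → depOf P (var y)) Y)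

data Step (φ : CNF) : State → State → Set where
  frege-ax  : ∀ {P Ls F} → FregeAxiom F → Step φ ⟨ P , Ls ⟩ ⟨ P , Ls ++ (F ∷ []) ⟩
  frege-mp  : ∀ {P Ls A F} → A ∈ Ls → (A ⇒ F) ∈ Ls → Step φ ⟨ P , Ls ⟩ ⟨ P , Ls ++ (F ∷ []) ⟩
  axiom     : ∀ {P Ls c} → c ∈ φ → Step φ ⟨ P , Ls ⟩ ⟨ P , Ls ++ (clauseF c ∷ []) ⟩
  indExt∧   : ∀ {P Ls} (α Y : List Lit) (w : ℕ)
            → All (λ a → var a ∈ U P) α
            → All (λ y → var y ∈ (U P ++ E P)) Y
            → Fresh φ ⟨ P , Ls ⟩ w
            → Step φ ⟨ P , Ls ⟩ ⟨ addE P w (indDep P α Y) , Ls ++ ((conjF α ⇒ (v w ⇔ conjF Y)) ∷ []) ⟩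
  indExt∨   : ∀ {P Ls} (α Y : List Lit) (w : ℕ)
            → All (λ a → var a ∈ U P) α
            → All (λ y → var y ∈ (U P ++ E P)) Y
            → Fresh φ ⟨ P , Ls ⟩ w
            → Step φ ⟨ P , Ls ⟩ ⟨ addE P w (indDep P α Y) , Ls ++ ((conjF α ⇒ (v w ⇔ disjF Y)) ∷ []) ⟩
  ∀red      : ∀ {P Ls L u} (b : Form) → (b ≡ ⊤' ⊎ b ≡ ⊥')
            → L ∈ Ls → u ∈ U P
            → (∀ {x} → Occ x L → x ∈ E P → u ∉ dep P x)
            → Step φ ⟨ P , Ls ⟩ ⟨ P , Ls ++ (subst u b L ∷ []) ⟩
  weakenU   : ∀ {P Ls} (w : ℕ) → Fresh φ ⟨ P , Ls ⟩ w
            → Step φ ⟨ P , Ls ⟩ ⟨ addU P w , Ls ⟩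
  weakenE   : ∀ {P Ls} (w : ℕ) (D : List ℕ) → Fresh φ ⟨ P , Ls ⟩ w → D ⊆ U P
            → Step φ ⟨ P , Ls ⟩ ⟨ addE P w D , Ls ⟩

data Deriv (φ : CNF) : ℕ → State → State → Set where
  done : ∀ {S} → Deriv φ 0 S S
  step : ∀ {n S S′ S″} → Step φ S S′ → Deriv φ n S′ S″ → Deriv φ (suc n) S S″

initState : DQBF → State
initState Φ = ⟨ prefix Φ , [] ⟩

renameLit : Lit → ℕ → Lit → Lit
renameLit l l′ m = if does (var m ≟ var l)
                   then (if eqLit m l then pos l′ else neg l′)
                   else m

renameC : Lit → ℕ → Clause → Clause
renameC l l′ = map (renameLit l l′)

-- The new variable is l′ ↔ l ∨ a, where a ↔ ⋀ o_D over the clauses D of φ that contain l̄ and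
-- o_D ↔ ⋁ O_D. All three are introduced by IndExt with empty α, so D_l′ is the union of D_var(l)
-- and the dependency sets of the outer literals, which lie in D_var(l) by definition of O_D.
-- A clause D of φ gives D′ literal by literal: literals of other variables are unchanged, l gives
-- l′ by l → l′, and l̄ gives either ¬l′ ∈ D′ or, from l′ ∧ l̄, first a, then o_D, then a literal
-- of O_D ⊆ D′. For C′ (a tautology if l̄ ∈ C), the hypothesis makes C ∨ O_D ∨ l derivable by
-- resolution along the unit propagation; this clause yields C′ ∨ o_D, these yield C′ ∨ a, and a → l′ ∈ C′.
-- With N = 4 (|Φ| + 1), every Frege proof below has size at most c · N ^ k for numerals c and k, and
-- the whole derivation has at most c · N ^ 6 lines.

module Submission where

open import Defs hiding (subst)
open import Data.Bool using (Bool; true; false; T; T?; not; _∨_; if_then_else_)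
open import Data.Bool.Properties using (T-∧; T-∨)
open import Data.Empty using (⊥-elim)
open import Data.List using (List; []; _∷_; _++_; map; length; filter)
open import Data.List.Extrema.Nat using (max; xs≤max)
open import Data.List.Properties using (length-map; length-++; map-++; length-filter; filter-all; filter-notAll; length-removeAt′)
open import Data.List.Membership.Propositional using (_∈_; _∉_; find)
open import Data.List.Membership.Propositional.Properties
  using (∈-++⁺ˡ; ∈-++⁺ʳ; ∈-++⁻; ∈-map⁺; ∈-map⁻; ∈-filter⁺; ∈-filter⁻; ∈-concatMap⁺; ∈-concatMap⁻)
open import Data.List.Relation.Binary.Subset.Propositional using () renaming (_⊆_ to _⊆ˡ_)
open import Data.List.Relation.Unary.All as All using (All; []; _∷_)
open import Data.List.Relation.Unary.Any as Any using (Any; here; there; _─_)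
open import Data.List.Relation.Unary.Unique.Propositional using (Unique)
open import Data.List.Relation.Unary.AllPairs using (_∷_)
open import Data.Nat.ListAction using (sum)
open import Data.Nat.ListAction.Properties using (sum-++)
open import Data.Nat using (ℕ; zero; suc; _+_; _*_; _^_; _≤_; _<_; z≤n; s≤s; _≟_; _≤?_; NonZero)
open import Data.Nat.Properties
open import Data.Nat.Tactic.RingSolver using (solve-∀)
open import Data.Product using (Σ; ∃; _×_; _,_; proj₁; proj₂; map₂)
open import Data.Sum using (_⊎_; inj₁; inj₂; [_,_]′)
open import Function using (id; _∘_; Equivalence)
open import Relation.Binary.Definitions using (DecidableEquality)
open import Relation.Binary.PropositionalEquality using (_≡_; _≢_; refl; sym; trans; cong; cong₂; subst)
open import Relation.Nullary using (¬_; Dec; yes; no; does; ¬?)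
open import Relation.Nullary.Decidable using (True; toWitness; map′; dec-true; dec-false)
import Data.List.Membership.DecPropositional as DecMembership

∈-─⁺ : ∀ {A : Set} {x z : A} {ys} (x∈ys : x ∈ ys) → z ∈ ys → z ≢ x → z ∈ (ys ─ x∈ys)
∈-─⁺ (here refl) (here refl) z≢x = ⊥-elim (z≢x refl)
∈-─⁺ (here refl) (there z∈)  _   = z∈
∈-─⁺ (there x∈)  (here refl) _   = here refl
∈-─⁺ (there x∈)  (there z∈)  z≢x = there (∈-─⁺ x∈ z∈ z≢x)

length-unique-⊆ : ∀ {A : Set} {xs ys : List A} → Unique xs → xs ⊆ˡ ys → length xs ≤ length ys
length-unique-⊆ {xs = []}     _              _   = z≤n
length-unique-⊆ {xs = x ∷ xs} {ys} (x∉xs ∷ u) sub =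
  ≤-trans (s≤s (length-unique-⊆ u (λ z∈ → ∈-─⁺ x∈ys (sub (there z∈)) (λ { refl → All.lookup x∉xs z∈ refl }))))
          (≤-reflexive (sym (length-removeAt′ ys (Any.index x∈ys))))
  where
    x∈ys = sub (here refl)

pos-injective : ∀ {x y} → pos x ≡ pos y → x ≡ y
pos-injective refl = refl

neg-injective : ∀ {x y} → _≡_ {A = Lit} (neg x) (neg y) → x ≡ y
neg-injective refl = refl

_≟ᴸ_ : DecidableEquality Lit
pos x ≟ᴸ pos y = map′ (cong pos) pos-injective (x ≟ y)
neg x ≟ᴸ neg y = map′ (cong neg) neg-injective (x ≟ y)
pos x ≟ᴸ neg y = no λ ()
neg x ≟ᴸ pos y = no λ ()

open DecMembership _≟ᴸ_ using () renaming (_∈?_ to _∈ᴸ?_)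
open DecMembership _≟_ using () renaming (_∈?_ to _∈ᴺ?_)

eqLit≡does : ∀ m k → eqLit m k ≡ does (m ≟ᴸ k)
eqLit≡does (pos x) (pos y) = refl
eqLit≡does (neg x) (neg y) = refl
eqLit≡does (pos x) (neg y) = refl
eqLit≡does (neg x) (pos y) = refl

compl-involutive : ∀ k → compl (compl k) ≡ k
compl-involutive (pos x) = refl
compl-involutive (neg x) = refl

var-compl : ∀ k → var (compl k) ≡ var k
var-compl (pos x) = refl
var-compl (neg x) = refl

same-var : ∀ m k → var m ≡ var k → m ≡ k ⊎ m ≡ compl k
same-var (pos x) (pos .x) refl = inj₁ refl
same-var (pos x) (neg .x) refl = inj₂ refl
same-var (neg x) (pos .x) refl = inj₂ refl
same-var (neg x) (neg .x) refl = inj₁ refl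

compl-≢ : ∀ k → compl k ≢ k
compl-≢ (pos x) ()
compl-≢ (neg x) ()

rename-other : ∀ l w {m} → var m ≢ var l → renameLit l w m ≡ m
rename-other l w {m} m≢l = cong (λ b → if b then (if eqLit m l then pos w else neg w) else m) (dec-false (var m ≟ var l) m≢l)

rename-same-var : ∀ l w {m} → var m ≡ var l → renameLit l w m ≡ (if eqLit m l then pos w else neg w)
rename-same-var l w {m} m≡l = cong (λ b → if b then (if eqLit m l then pos w else neg w) else m) (dec-true (var m ≟ var l) m≡l)

rename-self : ∀ l w → renameLit l w l ≡ pos w
rename-self l w = trans (rename-same-var l w {l} refl)
                        (cong (λ b → if b then pos w else neg w) (trans (eqLit≡does l l) (dec-true (l ≟ᴸ l) refl)))

rename-compl : ∀ l w → renameLit l w (compl l) ≡ neg w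
rename-compl l w = trans (rename-same-var l w {compl l} (var-compl l))
                         (cong (λ b → if b then pos w else neg w) (trans (eqLit≡does (compl l) l) (dec-false (compl l ≟ᴸ l) (compl-≢ l))))

∈-rename⁺ : ∀ l w {m K} → m ∈ K → renameLit l w m ∈ renameC l w K
∈-rename⁺ l w = ∈-map⁺ (renameLit l w)

filterB≡filter : ∀ {A : Set} {P : A → Set} (p : A → Bool) (P? : ∀ x → Dec (P x))
               → (∀ x → p x ≡ does (P? x)) → ∀ xs → filterB p xs ≡ filter P? xs
filterB≡filter p P? p≡ [] = refl
filterB≡filter p P? p≡ (x ∷ xs) rewrite p≡ x with does (P? x)
... | true  = cong (x ∷_) (filterB≡filter p P? p≡ xs)
... | false = filterB≡filter p P? p≡ xs

memb≡does : ∀ x ys → memb x ys ≡ does (x ∈ᴺ? ys)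
memb≡does x []       = refl
memb≡does x (y ∷ ys) = cong (does (x ≟ y) ∨_) (memb≡does x ys)

T-does : ∀ {P : Set} (P? : Dec P) → T (does P?) → P
T-does (yes p) _ = p

memb⇒∈ : ∀ {x ys} → T (memb x ys) → x ∈ ys
memb⇒∈ {x} {ys} t rewrite memb≡does x ys = T-does (x ∈ᴺ? ys) t

∉⇒memb≡false : ∀ {x ys} → x ∉ ys → memb x ys ≡ false
∉⇒memb≡false {x} {ys} x∉ys rewrite memb≡does x ys = dec-false (x ∈ᴺ? ys) x∉ys

subsetB⇒⊆ : ∀ xs ys → T (subsetB xs ys) → xs ⊆ ys
subsetB⇒⊆ (x ∷ xs) ys t (here refl) = memb⇒∈ (proj₁ (Equivalence.to T-∧ t))
subsetB⇒⊆ (x ∷ xs) ys t (there h)   = subsetB⇒⊆ xs ys (proj₂ (Equivalence.to (T-∧ {memb x ys}) t)) h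

filterB-const-true : ∀ {A : Set} (xs : List A) → filterB (λ _ → true) xs ≡ xs
filterB-const-true []       = refl
filterB-const-true (x ∷ xs) = cong (x ∷_) (filterB-const-true xs)

T-not-does⇒≢ : ∀ {x y} → T (not (does (x ≟ y))) → x ≢ y
T-not-does⇒≢ {x} t refl rewrite dec-true (x ≟ x) refl = t

∈-filterB⁻ : ∀ {A : Set} (p : A → Bool) {x} xs → x ∈ filterB p xs → x ∈ xs × T (p x)
∈-filterB⁻ p xs x∈ = ∈-filter⁻ (T? ∘ p) (subst (_ ∈_) (filterB≡filter p (T? ∘ p) (λ _ → refl) xs) x∈)

dep-addE-≢ : ∀ P {w D z} → z ≢ w → dep (addE P w D) z ≡ dep P z
dep-addE-≢ P {w} {D} {z} z≢w = cong (λ b → if b then D else dep P z) (dec-false (z ≟ w) z≢w)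

dep-addE-≡ : ∀ P w D → dep (addE P w D) w ≡ D
dep-addE-≡ P w D = cong (λ b → if b then D else dep P w) (dec-true (w ≟ w) refl)

depOf-∉U : ∀ P {z} → z ∉ U P → depOf P z ≡ dep P z
depOf-∉U P {z} z∉U = cong (λ b → if b then z ∷ [] else dep P z) (∉⇒memb≡false z∉U)

depOf-∈U : ∀ P {z} → z ∈ U P → depOf P z ≡ z ∷ []
depOf-∈U P {z} z∈U = cong (λ b → if b then z ∷ [] else dep P z) (trans (memb≡does z (U P)) (dec-true (z ∈ᴺ? U P) z∈U))

∈-indDep⁻ : ∀ P Y {z} → z ∈ indDep P [] Y → Any (λ y → z ∈ depOf P (var y)) Y
∈-indDep⁻ P Y z∈ = ∈-concatMap⁻ (λ y → depOf P (var y)) (subst (_ ∈_) (filterB-const-true _) z∈)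

module _ (P : Prefix) (l : Lit) (disjoint : ∀ {x} → x ∈ U P → x ∉ E P) (l∈E : var l ∈ E P) where

  ∈-outer⁻ : ∀ D {y} → y ∈ outer P l D → y ∈ D × depOf P (var y) ⊆ dep P (var l) × var y ≢ var l
  ∈-outer⁻ D {y} y∈ with ∈-filterB⁻ _ D y∈
  ... | y∈D , kept with Equivalence.to T-∨ kept
  ... | inj₁ existential = y∈D , subst (_⊆ dep P (var l)) (sym (depOf-∉U P y∉U)) (subsetB⇒⊆ _ _ y-deps) , T-not-does⇒≢ y≢l
    where
      parts = Equivalence.to T-∧ existential
      y∈E = memb⇒∈ (proj₁ parts)
      y-deps = proj₁ (Equivalence.to T-∧ (proj₂ parts))
      y≢l = proj₂ (Equivalence.to T-∧ (proj₂ parts))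
      y∉U : var y ∉ U P
      y∉U y∈U = disjoint y∈U y∈E
  ... | inj₂ universal = y∈D , subst (_⊆ dep P (var l)) (sym (depOf-∈U P y∈U)) (λ { (here refl) → memb⇒∈ (proj₂ parts) })
                             , λ y≡l → disjoint y∈U (subst (_∈ E P) (sym y≡l) l∈E)
    where
      parts = Equivalence.to T-∧ universal
      y∈U = memb⇒∈ (proj₁ parts)

definition : ℕ → Form → Form
definition w G = ⊤' ⇒ (v w ⇔ G)

occurs-litF : ∀ {x} y → Occ x (litF y) → var y ≡ x
occurs-litF (pos z) here       = refl
occurs-litF (neg z) (neg here) = refl

occurs-clauseF : ∀ {x} Y → Occ x (clauseF Y) → x ∈ map var Y
occurs-clauseF (y ∷ Y) (orL o) = here (sym (occurs-litF y o))
occurs-clauseF (y ∷ Y) (orR o) = there (occurs-clauseF Y o)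

occurs-conjF : ∀ {x} Y → Occ x (conjF Y) → x ∈ map var Y
occurs-conjF (y ∷ Y) (andL o) = here (sym (occurs-litF y o))
occurs-conjF (y ∷ Y) (andR o) = there (occurs-conjF Y o)

occurs-definition : ∀ {x w G} → Occ x (definition w G) → x ≡ w ⊎ Occ x G
occurs-definition (impR (andL (impL here))) = inj₁ refl
occurs-definition (impR (andL (impR o)))    = inj₂ o
occurs-definition (impR (andR (impL o)))    = inj₂ o
occurs-definition (impR (andR (impR here))) = inj₁ refl

-- Frege proofs from hypotheses Γ and the clauses of φ

module Frege (φ : CNF) where

  infix 3 _⊢_
  data _⊢_ (Γ : List Form) : Form → Set where
    axiom  : ∀ {A} → FregeAxiom A → Γ ⊢ A
    hyp    : ∀ {A} → A ∈ Γ → Γ ⊢ A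
    clause : ∀ {c} → c ∈ φ → Γ ⊢ clauseF c
    mp     : ∀ {A B} → Γ ⊢ A → Γ ⊢ A ⇒ B → Γ ⊢ B

  proofSize : ∀ {Γ A} → Γ ⊢ A → ℕ
  proofSize (axiom _)  = 1
  proofSize (hyp _)    = 0
  proofSize (clause _) = 1
  proofSize (mp p q)   = suc (proofSize p + proofSize q)

  ⇒-refl : ∀ {Γ} A → Γ ⊢ A ⇒ A
  ⇒-refl A = mp (axiom (ax1 A (A ⇒ A))) (mp (axiom (ax1 A A)) (axiom (ax2 A (A ⇒ A) A)))

  deduction : ∀ {Γ A B} → A ∷ Γ ⊢ B → Γ ⊢ A ⇒ B
  deduction {A = A} (axiom {B} a)        = mp (axiom a) (axiom (ax1 B A))
  deduction {A = A} (hyp (here refl))    = ⇒-refl A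
  deduction {A = A} (hyp {B} (there h))  = mp (hyp h) (axiom (ax1 B A))
  deduction {A = A} (clause {c} c∈φ)     = mp (clause c∈φ) (axiom (ax1 (clauseF c) A))
  deduction {A = A} (mp {C} {B} p q)     = mp (deduction q) (mp (deduction p) (axiom (ax2 A C B)))

  private
    #0 : ∀ {Γ A} → A ∷ Γ ⊢ A
    #0 = hyp (here refl)
    #1 : ∀ {Γ A B} → B ∷ A ∷ Γ ⊢ A
    #1 = hyp (there (here refl))
    #2 : ∀ {Γ A B C} → C ∷ B ∷ A ∷ Γ ⊢ A
    #2 = hyp (there (there (here refl)))

  ⇒-trans : ∀ {Γ} A B C → Γ ⊢ (A ⇒ B) ⇒ (B ⇒ C) ⇒ (A ⇒ C)
  ⇒-trans A B C = deduction (deduction (deduction (mp (mp #0 #2) #1)))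

  ∨-elim : ∀ {Γ} A B C → Γ ⊢ (A ⇒ C) ⇒ (B ⇒ C) ⇒ (A ∨' B) ⇒ C
  ∨-elim A B C = axiom (ax8 A B C)

  explosion : ∀ {Γ} A B → Γ ⊢ A ⇒ ¬' A ⇒ B
  explosion A B = deduction (deduction (mp (mp (mp #0 (axiom (ax1 (¬' A) (¬' B))))
                    (mp (mp #1 (axiom (ax1 A (¬' B)))) (axiom (ax9 (¬' B) A)))) (axiom (ax10 B))))

  -- Proved like explosion rather than from it, which would multiply its size.
  explosion′ : ∀ {Γ} A B → Γ ⊢ ¬' A ⇒ A ⇒ B
  explosion′ A B = deduction (deduction (mp (mp (mp #1 (axiom (ax1 (¬' A) (¬' B))))
                     (mp (mp #0 (axiom (ax1 A (¬' B)))) (axiom (ax9 (¬' B) A)))) (axiom (ax10 B))))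

  excluded-middle : ∀ {Γ} A → Γ ⊢ A ∨' ¬' A
  excluded-middle A = mp (mp ¬¬A (mp ¬A (axiom (ax9 X (¬' A))))) (axiom (ax10 (A ∨' ¬' A)))
    where
      X = ¬' (A ∨' ¬' A)
      ¬A : ∀ {Γ} → Γ ⊢ X ⇒ ¬' A
      ¬A = deduction (mp (mp #0 (axiom (ax1 X A))) (mp (axiom (ax6 A (¬' A))) (axiom (ax9 A (A ∨' ¬' A)))))
      ¬¬A : ∀ {Γ} → Γ ⊢ X ⇒ ¬' ¬' A
      ¬¬A = deduction (mp (mp #0 (axiom (ax1 X (¬' A)))) (mp (axiom (ax7 A (¬' A))) (axiom (ax9 (¬' A) (A ∨' ¬' A)))))

  ∨-distrib-∧ : ∀ {Γ} A B C → Γ ⊢ (A ∨' B) ⇒ (A ∨' C) ⇒ (A ∨' (B ∧' C))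
  ∨-distrib-∧ A B C = deduction (deduction (mp #1 (mp (deduction B⊢) (mp (axiom (ax6 A (B ∧' C))) (axiom (ax8 A B _))))))
    where
      C⊢ : ∀ {Γ} → C ∷ B ∷ Γ ⊢ A ∨' (B ∧' C)
      C⊢ = mp (mp #0 (mp #1 (axiom (ax3 B C)))) (axiom (ax7 A (B ∧' C)))
      B⊢ : ∀ {Γ} → B ∷ (A ∨' C) ∷ Γ ⊢ A ∨' (B ∧' C)
      B⊢ = mp #1 (mp (deduction C⊢) (mp (axiom (ax6 A (B ∧' C))) (axiom (ax8 A C _))))

  lit-explosion : ∀ {Γ} k B → Γ ⊢ litF k ⇒ litF (compl k) ⇒ B
  lit-explosion (pos x) B = explosion (v x) B
  lit-explosion (neg x) B = explosion′ (v x) B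

  lit-explosion′ : ∀ {Γ} k B → Γ ⊢ litF (compl k) ⇒ litF k ⇒ B
  lit-explosion′ (pos x) B = explosion′ (v x) B
  lit-explosion′ (neg x) B = explosion (v x) B

  lit-excluded-middle : ∀ {Γ} k → Γ ⊢ litF k ∨' litF (compl k)
  lit-excluded-middle (pos x) = excluded-middle (v x)
  lit-excluded-middle (neg x) =
    mp (excluded-middle (v x)) (mp (axiom (ax6 (¬' v x) (v x))) (mp (axiom (ax7 (¬' v x) (v x))) (∨-elim _ _ _)))

  definition⇒ : ∀ {Γ w G} → definition w G ∈ Γ → Γ ⊢ v w ⇒ G
  definition⇒ {w = w} {G} def = mp (mp (axiom ax11) (hyp def)) (axiom (ax4 (v w ⇒ G) (G ⇒ v w)))

  definition⇐ : ∀ {Γ w G} → definition w G ∈ Γ → Γ ⊢ G ⇒ v w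
  definition⇐ {w = w} {G} def = mp (mp (axiom ax11) (hyp def)) (axiom (ax5 (v w ⇒ G) (G ⇒ v w)))

  ⋁-intro : ∀ {Γ m K} → m ∈ K → Γ ⊢ litF m ⇒ clauseF K
  ⋁-intro {m = m} {K = _ ∷ K} (here refl) = axiom (ax6 (litF m) (clauseF K))
  ⋁-intro {K = k ∷ K} (there h) = mp (axiom (ax7 (litF k) (clauseF K))) (mp (⋁-intro h) (⇒-trans _ _ _))

  ⋁-elim : ∀ {Γ T} K → (∀ {m} → m ∈ K → Γ ⊢ litF m ⇒ T) → Γ ⊢ clauseF K ⇒ T
  ⋁-elim {T = T} []    f = axiom (ax12 T)
  ⋁-elim         (k ∷ K) f = mp (⋁-elim K (f ∘ there)) (mp (f (here refl)) (∨-elim _ _ _))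

  ⋀-elim : ∀ {Γ y Y} → y ∈ Y → Γ ⊢ conjF Y ⇒ litF y
  ⋀-elim {y = y} {Y = _ ∷ Y} (here refl) = axiom (ax4 (litF y) (conjF Y))
  ⋀-elim {Y = k ∷ Y} (there h) = mp (⋀-elim h) (mp (axiom (ax5 (litF k) (conjF Y))) (⇒-trans _ _ _))

  ∨-⋀-intro : ∀ {Γ} A os → (∀ {o} → o ∈ os → A ∨' v o ∈ Γ) → Γ ⊢ A ∨' conjF (map pos os)
  ∨-⋀-intro A []       _      = mp (axiom ax11) (axiom (ax7 A ⊤'))
  ∨-⋀-intro A (o ∷ os) A∨o∈Γ =
    mp (∨-⋀-intro A os (A∨o∈Γ ∘ there)) (mp (hyp (A∨o∈Γ (here refl))) (∨-distrib-∧ A (v o) _))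

  private
    +164 : ∀ x → suc (suc (suc (x + 161))) ≡ x + 164
    +164 = solve-∀

  proofSize-⋁-intro : ∀ {Γ m K} (h : m ∈ K) → proofSize (⋁-intro {Γ} h) ≤ 164 * length K
  proofSize-⋁-intro {K = _ ∷ K} (here refl) = m≤m+n 1 _
  proofSize-⋁-intro {Γ} {K = k ∷ K} (there h) = begin
    suc (suc (suc (proofSize (⋁-intro {Γ} h) + 161))) ≡⟨ +164 _ ⟩
    proofSize (⋁-intro {Γ} h) + 164                   ≤⟨ +-monoˡ-≤ 164 (proofSize-⋁-intro h) ⟩
    164 * length K + 164                              ≡⟨ +-comm _ 164 ⟩
    164 + 164 * length K                              ≡⟨ *-suc 164 (length K) ⟨
    164 * suc (length K)                              ∎
    where open ≤-Reasoning

  proofSize-⋀-elim : ∀ {Γ y Y} (h : y ∈ Y) → proofSize (⋀-elim {Γ} h) ≤ 164 * length Y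
  proofSize-⋀-elim {Y = _ ∷ Y} (here refl) = m≤m+n 1 _
  proofSize-⋀-elim {Γ} {Y = k ∷ Y} (there h) = begin
    suc (proofSize (⋀-elim {Γ} h) + 163) ≡⟨ +-suc _ 163 ⟨
    proofSize (⋀-elim {Γ} h) + 164                   ≤⟨ +-monoˡ-≤ 164 (proofSize-⋀-elim h) ⟩
    164 * length Y + 164                              ≡⟨ +-comm _ 164 ⟩
    164 + 164 * length Y                              ≡⟨ *-suc 164 (length Y) ⟨
    164 * suc (length Y)                              ∎
    where open ≤-Reasoning

  proofSize-∨-⋀-intro : ∀ {Γ} A os (A∨o∈Γ : ∀ {o} → o ∈ os → A ∨' v o ∈ Γ)
                      → proofSize (∨-⋀-intro A os A∨o∈Γ) ≤ 865 * length os + 3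
  proofSize-∨-⋀-intro A []       _      = ≤-refl
  proofSize-∨-⋀-intro A (o ∷ os) A∨o∈Γ = begin
    suc (proofSize (∨-⋀-intro A os (A∨o∈Γ ∘ there)) + 864) ≡⟨ +-suc _ 864 ⟨
    proofSize (∨-⋀-intro A os (A∨o∈Γ ∘ there)) + 865  ≤⟨ +-monoˡ-≤ 865 (proofSize-∨-⋀-intro A os (A∨o∈Γ ∘ there)) ⟩
    865 * length os + 3 + 865                        ≡⟨ lemma (length os) ⟩
    865 * suc (length os) + 3                        ∎
    where
      open ≤-Reasoning
      lemma : ∀ n → 865 * n + 3 + 865 ≡ 865 * suc n + 3
      lemma = solve-∀

  proofSize-⋁-elim : ∀ {Γ T} K (f : ∀ {m} → m ∈ K → Γ ⊢ litF m ⇒ T) b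
                   → (∀ {m} (h : m ∈ K) → proofSize (f h) ≤ b)
                   → proofSize (⋁-elim K f) ≤ length K * (b + 3) + 1
  proofSize-⋁-elim []      f b f≤b = ≤-refl
  proofSize-⋁-elim (k ∷ K) f b f≤b = begin
    suc (proofSize (⋁-elim K (f ∘ there)) + suc (proofSize (f (here refl)) + 1))
      ≤⟨ s≤s (+-mono-≤ (proofSize-⋁-elim K (f ∘ there) b (f≤b ∘ there)) (s≤s (+-monoˡ-≤ 1 (f≤b (here refl))))) ⟩
    suc (length K * (b + 3) + 1 + suc (b + 1))  ≡⟨ lemma (length K * (b + 3)) b ⟩
    (b + 3) + length K * (b + 3) + 1           ∎
    where
      open ≤-Reasoning
      lemma : ∀ x b → suc (x + 1 + suc (b + 1)) ≡ (b + 3) + x + 1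
      lemma = solve-∀

-- Proofs of size at most c · N ^ k

module Bounded (φ : CNF) (N : ℕ) .{{_ : NonZero N}} where
  open Frege φ public

  1≤N^ : ∀ k → 1 ≤ N ^ k
  1≤N^ = m^n>0 N

  c≤c*N^ : ∀ c k → c ≤ c * N ^ k
  c≤c*N^ c k = ≤-trans (≤-reflexive (sym (*-identityʳ c))) (*-monoʳ-≤ c (1≤N^ k))

  infix 3 _⊢⟨_,_⟩_
  record _⊢⟨_,_⟩_ (Γ : List Form) (k c : ℕ) (A : Form) : Set where
    constructor _,_
    field
      proof   : Γ ⊢ A
      bounded : proofSize proof ≤ c * N ^ k
  open _⊢⟨_,_⟩_ public

  closed : ∀ {Γ A k} (p : Γ ⊢ A) → Γ ⊢⟨ k , proofSize p ⟩ A
  closed {k = k} p = p , c≤c*N^ (proofSize p) k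

  assumption : ∀ {Γ A k} → A ∈ Γ → Γ ⊢⟨ k , 0 ⟩ A
  assumption A∈Γ = hyp A∈Γ , z≤n

  weaken : ∀ {Γ A k a b} → a ≤ b → Γ ⊢⟨ k , a ⟩ A → Γ ⊢⟨ k , b ⟩ A
  weaken {k = k} a≤b (p , p≤) = p , ≤-trans p≤ (*-monoˡ-≤ (N ^ k) a≤b)

  raise-degree : ∀ a {j k} → j ≤ k → a * N ^ j ≤ a * N ^ k
  raise-degree a j≤k = *-monoʳ-≤ a (^-monoʳ-≤ N j≤k)

  raise : ∀ {Γ A j k a} → j ≤ k → Γ ⊢⟨ j , a ⟩ A → Γ ⊢⟨ k , a ⟩ A
  raise {a = a} j≤k (p , p≤) = p , ≤-trans p≤ (raise-degree a j≤k)

  mpᵇ : ∀ {Γ A B k a b} → Γ ⊢⟨ k , a ⟩ A → Γ ⊢⟨ k , b ⟩ A ⇒ B → Γ ⊢⟨ k , suc (a + b) ⟩ B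
  mpᵇ {k = k} {a} {b} (p , p≤) (q , q≤) =
    mp p q , +-mono-≤ (1≤N^ k) (≤-trans (+-mono-≤ p≤ q≤) (≤-reflexive (sym (*-distribʳ-+ (N ^ k) a b))))

  infixr 5 _⨾_
  _⨾_ : ∀ {Γ A B C k a b} → Γ ⊢⟨ k , a ⟩ A ⇒ B → Γ ⊢⟨ k , b ⟩ B ⇒ C → Γ ⊢⟨ k , 163 + a + b ⟩ A ⇒ C
  _⨾_ {a = a} {b} p q = weaken (≤-reflexive (lemma a b)) (mpᵇ q (mpᵇ p (closed (⇒-trans _ _ _))))
    where
      lemma : ∀ a b → suc (b + suc (a + 161)) ≡ 163 + a + b
      lemma = solve-∀

  ∨-elimᵇ : ∀ {Γ A B C k a b} → Γ ⊢⟨ k , a ⟩ A ⇒ C → Γ ⊢⟨ k , b ⟩ B ⇒ C → Γ ⊢⟨ k , 3 + a + b ⟩ (A ∨' B) ⇒ C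
  ∨-elimᵇ {a = a} {b} p q = weaken (≤-reflexive (lemma a b)) (mpᵇ q (mpᵇ p (closed (∨-elim _ _ _))))
    where
      lemma : ∀ a b → suc (b + suc (a + 1)) ≡ 3 + a + b
      lemma = solve-∀

  ⋁-introᵇ : ∀ {Γ m K} → m ∈ K → length K ≤ N → Γ ⊢⟨ 1 , 164 ⟩ litF m ⇒ clauseF K
  ⋁-introᵇ m∈K K≤N = ⋁-intro m∈K , ≤-trans (proofSize-⋁-intro m∈K) (*-monoʳ-≤ 164 (≤-trans K≤N (≤-reflexive (sym (*-identityʳ N)))))

  ⋀-elimᵇ : ∀ {Γ y Y} → y ∈ Y → length Y ≤ N → Γ ⊢⟨ 1 , 164 ⟩ conjF Y ⇒ litF y
  ⋀-elimᵇ y∈Y Y≤N = ⋀-elim y∈Y , ≤-trans (proofSize-⋀-elim y∈Y) (*-monoʳ-≤ 164 (≤-trans Y≤N (≤-reflexive (sym (*-identityʳ N)))))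

  ∨-⋀-introᵇ : ∀ {Γ} A os → length os ≤ N → (∀ {o} → o ∈ os → A ∨' v o ∈ Γ) → Γ ⊢⟨ 1 , 868 ⟩ A ∨' conjF (map pos os)
  ∨-⋀-introᵇ A os os≤N A∨o∈Γ = ∨-⋀-intro A os A∨o∈Γ , (begin
    proofSize (∨-⋀-intro A os A∨o∈Γ)  ≤⟨ proofSize-∨-⋀-intro A os A∨o∈Γ ⟩
    865 * length os + 3               ≤⟨ +-mono-≤ (*-monoʳ-≤ 865 (≤-trans os≤N (≤-reflexive (sym (*-identityʳ N))))) (c≤c*N^ 3 1) ⟩
    865 * N ^ 1 + 3 * N ^ 1           ≡⟨ *-distribʳ-+ (N ^ 1) 865 3 ⟨
    868 * N ^ 1                       ∎)
    where open ≤-Reasoning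

  ⋁-elimᵇ : ∀ {Γ T k b} K → length K ≤ N → (∀ {m} → m ∈ K → Γ ⊢⟨ k , b ⟩ litF m ⇒ T)
          → Γ ⊢⟨ suc k , 4 + b ⟩ clauseF K ⇒ T
  ⋁-elimᵇ {k = k} {b} K K≤N f = ⋁-elim K (proof ∘ f) , (begin
    proofSize (⋁-elim K (proof ∘ f))    ≤⟨ proofSize-⋁-elim K _ (b * N ^ k) (bounded ∘ f) ⟩
    length K * (b * M + 3) + 1          ≤⟨ +-mono-≤ (*-monoˡ-≤ (b * M + 3) K≤N) (1≤N^ (suc k)) ⟩
    N * (b * M + 3) + N * M             ≤⟨ +-monoˡ-≤ (N * M) (*-monoʳ-≤ N (+-monoʳ-≤ (b * M) (c≤c*N^ 3 k))) ⟩
    N * (b * M + 3 * M) + N * M         ≡⟨ lemma N M b ⟩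
    (4 + b) * N ^ suc k                 ∎)
    where
      open ≤-Reasoning
      M = N ^ k
      lemma : ∀ N M b → N * (b * M + 3 * M) + N * M ≡ (4 + b) * (N * M)
      lemma = solve-∀

  ⋁-monoᵇ : ∀ {Γ} K K′ → K ⊆ᶜ K′ → length K ≤ N → length K′ ≤ N → Γ ⊢⟨ 2 , 168 ⟩ clauseF K ⇒ clauseF K′
  ⋁-monoᵇ K K′ K⊆K′ K≤N K′≤N = ⋁-elimᵇ K K≤N (λ m∈K → ⋁-introᵇ (K⊆K′ m∈K) K′≤N)

  ≤-compute : ∀ {m n} → True (m ≤? n) → m ≤ n
  ≤-compute = toWitness

  weaken-premise : ∀ {Γ A B k a} R → Γ ⊢⟨ k , a ⟩ A ⇒ B → Γ ⊢⟨ k , 164 + a ⟩ A ⇒ R ⇒ B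
  weaken-premise {a = a} R p = weaken (≤-reflexive (+-comm (163 + a) 1)) (p ⨾ closed (axiom (ax1 _ R)))

  definition⇒ᵇ : ∀ {Γ w G k} → definition w G ∈ Γ → Γ ⊢⟨ k , 4 ⟩ v w ⇒ G
  definition⇒ᵇ def = closed (definition⇒ def)

  definition⇐ᵇ : ∀ {Γ w G k} → definition w G ∈ Γ → Γ ⊢⟨ k , 4 ⟩ G ⇒ v w
  definition⇐ᵇ def = closed (definition⇐ def)

  lit-explosionᵇ : ∀ {Γ k} x B → Γ ⊢⟨ k , 107 ⟩ litF x ⇒ litF (compl x) ⇒ B
  lit-explosionᵇ (pos x) B = closed (lit-explosion (pos x) B)
  lit-explosionᵇ (neg x) B = closed (lit-explosion (neg x) B)

  lit-explosion′ᵇ : ∀ {Γ k} x B → Γ ⊢⟨ k , 107 ⟩ litF (compl x) ⇒ litF x ⇒ B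
  lit-explosion′ᵇ (pos x) B = closed (lit-explosion′ (pos x) B)
  lit-explosion′ᵇ (neg x) B = closed (lit-explosion′ (neg x) B)

  lit-excluded-middleᵇ : ∀ {Γ k} x → Γ ⊢⟨ k , 57 ⟩ litF x ∨' litF (compl x)
  lit-excluded-middleᵇ (pos x) = weaken (≤-compute _) (closed (lit-excluded-middle (pos x)))
  lit-excluded-middleᵇ (neg x) = closed (lit-excluded-middle (neg x))

  resolvent : ∀ {Γ K₁ K₂ T} x → clauseF K₁ ∈ Γ → clauseF K₂ ∈ Γ
            → (∀ {m} → m ∈ K₁ → m ≢ x → m ∈ T) → (∀ {m} → m ∈ K₂ → m ≢ compl x → m ∈ T)
            → length K₁ ≤ N → length K₂ ≤ N → length T ≤ N
            → Γ ⊢⟨ 3 , 338 ⟩ clauseF T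
  resolvent {Γ} {K₁} {K₂} {T} x K₁∈Γ K₂∈Γ sub₁ sub₂ K₁≤N K₂≤N T≤N =
    mpᵇ (assumption K₁∈Γ) (⋁-elimᵇ K₁ K₁≤N from-K₁)
    where
      from-K₂ : ∀ {m} → m ∈ K₂ → Γ ⊢⟨ 1 , 328 ⟩ litF m ⇒ litF x ⇒ clauseF T
      from-K₂ {m} m∈K₂ with m ≟ᴸ compl x
      ... | yes refl = weaken (≤-compute _) (lit-explosion′ᵇ x _)
      ... | no m≢x̄  = weaken-premise (litF x) (⋁-introᵇ (sub₂ m∈K₂ m≢x̄) T≤N)
      x⇒T : Γ ⊢⟨ 2 , 333 ⟩ litF x ⇒ clauseF T
      x⇒T = mpᵇ (assumption K₂∈Γ) (⋁-elimᵇ K₂ K₂≤N from-K₂)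
      from-K₁ : ∀ {m} → m ∈ K₁ → Γ ⊢⟨ 2 , 333 ⟩ litF m ⇒ clauseF T
      from-K₁ {m} m∈K₁ with m ≟ᴸ x
      ... | yes refl = x⇒T
      ... | no m≢x   = weaken (≤-compute _) (raise (s≤s z≤n) (⋁-introᵇ (sub₁ m∈K₁ m≢x) T≤N))

module _ {φ : CNF} where

  infixr 5 _++ᴰ_
  _++ᴰ_ : ∀ {n m S S′ S″} → Deriv φ n S S′ → Deriv φ m S′ S″ → Deriv φ (n + m) S S″
  done      ++ᴰ e = e
  step s d  ++ᴰ e = step s (d ++ᴰ e)

  step-grows : ∀ {S S′} → Step φ S S′ → lines S ⊆ˡ lines S′
  step-grows (frege-ax _)             = ∈-++⁺ˡ
  step-grows (frege-mp _ _)           = ∈-++⁺ˡ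
  step-grows (axiom _)                = ∈-++⁺ˡ
  step-grows (indExt∧ _ _ _ _ _ _)    = ∈-++⁺ˡ
  step-grows (indExt∨ _ _ _ _ _ _)    = ∈-++⁺ˡ
  step-grows (∀red _ _ _ _ _)         = ∈-++⁺ˡ
  step-grows (weakenU _ _)            = id
  step-grows (weakenE _ _ _ _)        = id

  lines-grow : ∀ {n S S′} → Deriv φ n S S′ → lines S ⊆ˡ lines S′
  lines-grow done       = id
  lines-grow (step s d) = lines-grow d ∘ step-grows s

  recount : ∀ {n m S S′} → n ≡ m → Deriv φ n S S′ → Deriv φ m S S′
  recount refl d = d

module Derivations (φ : CNF) (N : ℕ) .{{_ : NonZero N}} where
  open Bounded φ N public

  record Extension (P : Prefix) (Ls : List Form) (k c : ℕ) (Q : List Form → Set) : Set where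
    constructor extension
    field
      {steps}    : ℕ
      {lines′}   : List Form
      derivation : Deriv φ steps ⟨ P , Ls ⟩ ⟨ P , lines′ ⟩
      cost       : steps ≤ c * N ^ k
      result     : Q lines′

  module _ {P : Prefix} where

    pure : ∀ {Ls k c} {Q : List Form → Set} → Q Ls → Extension P Ls k c Q
    pure q = extension done z≤n q

    infixl 1 _>>=_
    _>>=_ : ∀ {Ls k a b} {Q R : List Form → Set} → Extension P Ls k a Q
          → (∀ {L} → Ls ⊆ˡ L → Q L → Extension P L k b R) → Extension P Ls k (a + b) R
    _>>=_ {k = k} {a} {b} (extension d n≤ q) f with f (lines-grow d) q
    ... | extension d′ n′≤ r =
      extension (d ++ᴰ d′) (≤-trans (+-mono-≤ n≤ n′≤) (≤-reflexive (sym (*-distribʳ-+ (N ^ k) a b)))) r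

    map-result : ∀ {Ls k c} {Q R : List Form → Set} → (∀ {L} → Ls ⊆ˡ L → Q L → R L)
               → Extension P Ls k c Q → Extension P Ls k c R
    map-result f (extension d n≤ q) = extension d n≤ (f (lines-grow d) q)

    relax : ∀ {Ls j k a b} {Q : List Form → Set} → Extension P Ls j a Q
          → a * N ^ j ≤ b * N ^ k → Extension P Ls k b Q
    relax (extension d n≤ q) ≤b = extension d (≤-trans n≤ ≤b) q

    loosen : ∀ {Ls k a b} {Q : List Form → Set} → a ≤ b → Extension P Ls k a Q → Extension P Ls k b Q
    loosen {k = k} a≤b ext = relax ext (*-monoˡ-≤ (N ^ k) a≤b)

    lift : ∀ {Ls j k a} {Q : List Form → Set} → j ≤ k → Extension P Ls j a Q → Extension P Ls k a Q
    lift {a = a} j≤k ext = relax ext (raise-degree a j≤k)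

    absorb : ∀ {Ls k m c} {Q : List Form → Set} → m ≤ N → Extension P Ls k (m * c) Q → Extension P Ls (suc k) c Q
    absorb {k = k} {m} {c} m≤N ext = relax ext (≤-trans (*-monoˡ-≤ (N ^ k) (*-monoˡ-≤ c m≤N)) (≤-reflexive (lemma N c (N ^ k))))
      where
        lemma : ∀ N c M → N * c * M ≡ c * (N * M)
        lemma = solve-∀

    private
      record Compiled (Ls : List Form) (n : ℕ) (A : Form) : Set where
        constructor compiled
        field
          {lines′}   : List Form
          derivation : Deriv φ n ⟨ P , Ls ⟩ ⟨ P , lines′ ⟩
          derived    : A ∈ lines′

      appended : ∀ (Ls : List Form) {F} → F ∈ Ls ++ (F ∷ [])
      appended Ls = ∈-++⁺ʳ Ls (here refl)

      compile : ∀ {Γ Ls A} → Γ ⊆ˡ Ls → (p : Γ ⊢ A) → Compiled Ls (proofSize p) A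
      compile {Ls = Ls} Γ⊆Ls (axiom a)  = compiled (step (frege-ax a) done) (appended Ls)
      compile {Ls = Ls} Γ⊆Ls (hyp A∈Γ)  = compiled done (Γ⊆Ls A∈Γ)
      compile {Ls = Ls} Γ⊆Ls (clause c) = compiled (step (axiom c) done) (appended Ls)
      compile {Ls = Ls} Γ⊆Ls (mp p q) with compile Γ⊆Ls p
      ... | compiled {L₁} d₁ A∈L₁ with compile (lines-grow d₁ ∘ Γ⊆Ls) q
      ... | compiled {L₂} d₂ A⇒B∈L₂ =
        compiled (recount (+-suc (proofSize p) (proofSize q))
                   (d₁ ++ᴰ recount (+-comm (proofSize q) 1) (d₂ ++ᴰ step (frege-mp (lines-grow d₂ A∈L₁) A⇒B∈L₂) done)))
                 (appended L₂)

    emit : ∀ {Γ Ls A k c} → Γ ⊆ˡ Ls → Γ ⊢⟨ k , c ⟩ A → Extension P Ls k c (A ∈_)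
    emit Γ⊆Ls (p , p≤) with compile Γ⊆Ls p
    ... | compiled d A∈L = extension d p≤ A∈L

    for-each : ∀ {X : Set} {Ls k c} (xs : List X) (Q : X → List Form → Set)
             → (∀ x {L L′} → L ⊆ˡ L′ → Q x L → Q x L′) → length xs ≤ N
             → (∀ {L} → Ls ⊆ˡ L → ∀ {x} → x ∈ xs → Extension P L k c (Q x))
             → Extension P Ls (suc k) c (λ L → ∀ {x} → x ∈ xs → Q x L)
    for-each {X} {k = k} {c} xs Q mono xs≤N f = absorb xs≤N (loop xs f)
      where
        loop : ∀ {Ls} ys → (∀ {L} → Ls ⊆ˡ L → ∀ {x} → x ∈ ys → Extension P L k c (Q x))
             → Extension P Ls k (length ys * c) (λ L → ∀ {x} → x ∈ ys → Q x L)
        loop []       f = pure λ ()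
        loop (y ∷ ys) f =
          f id (here refl) >>= λ e q →
          map-result (λ e′ r → λ { (here refl) → mono y e′ q ; (there h) → r h })
                     (loop ys (λ e′ → f (e′ ∘ e) ∘ there))

-- Reverse unit propagation

reduce : Lit → Clause → Clause
reduce k = filterB (λ m → not (eqLit m (compl k)))

total : CNF → ℕ
total ψ = sum (map length ψ)

total-++ : ∀ ψ χ → total (ψ ++ χ) ≡ total ψ + total χ
total-++ ψ χ = trans (cong sum (map-++ length ψ χ)) (sum-++ (map length ψ) (map length χ))

total-negUnits : ∀ K → total (negUnits K) ≡ length K
total-negUnits []      = refl
total-negUnits (k ∷ K) = cong suc (total-negUnits K)

module _ (k : Lit) where

  private
    keep? : ∀ m → Dec (m ≢ compl k)
    keep? m = ¬? (m ≟ᴸ compl k)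

  reduce≡filter : ∀ K → reduce k K ≡ filter keep? K
  reduce≡filter = filterB≡filter _ keep? (λ m → cong not (eqLit≡does m (compl k)))

  ∈-reduce⁺ : ∀ {m K} → m ∈ K → m ≢ compl k → m ∈ reduce k K
  ∈-reduce⁺ {K = K} m∈K m≢k̄ rewrite reduce≡filter K = ∈-filter⁺ keep? m∈K m≢k̄

  length-reduce : ∀ K → length (reduce k K) ≤ length K
  length-reduce K rewrite reduce≡filter K = length-filter keep? K

  total-reduce : ∀ ψ → total (map (reduce k) ψ) ≤ total ψ
  total-reduce []      = z≤n
  total-reduce (K ∷ ψ) = +-mono-≤ (length-reduce K) (total-reduce ψ)

  total-reduce< : ∀ ψ → Any (compl k ∈_) ψ → total (map (reduce k) ψ) < total ψ
  total-reduce< (K ∷ ψ) (here k̄∈K) rewrite reduce≡filter K =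
    +-mono-<-≤ (filter-notAll keep? K (Any.map (λ { refl k̄≢k̄ → k̄≢k̄ refl }) k̄∈K)) (total-reduce ψ)
  total-reduce< (K ∷ ψ) (there k̄∈ψ) = +-mono-≤-< (length-reduce K) (total-reduce< ψ k̄∈ψ)

  reduce-unused : ∀ ψ → ¬ Any (compl k ∈_) ψ → map (reduce k) ψ ≡ ψ
  reduce-unused []      _ = refl
  reduce-unused (K ∷ ψ) k̄∉ψ rewrite reduce≡filter K =
    cong₂ _∷_ (filter-all keep? (All.tabulate λ { m∈K refl → k̄∉ψ (here m∈K) })) (reduce-unused ψ (k̄∉ψ ∘ there))

module UnitPropagation (φ : CNF) (N : ℕ) .{{_ : NonZero N}} (P : Prefix) (X : Clause) where
  open Derivations φ N

  Derived : CNF → List Form → Set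
  Derived ψ L = ∀ {K} → K ∈ ψ → clauseF (K ++ X) ∈ L

  resolve-unit : ∀ {Ls} k K → clauseF (K ++ X) ∈ Ls → clauseF (k ∷ X) ∈ Ls
               → length (K ++ X) ≤ N → length (k ∷ X) ≤ N → Ls ⊢⟨ 3 , 338 ⟩ clauseF (reduce k K ++ X)
  resolve-unit k K K∈ k∈ K≤N k≤N = resolvent (compl k) K∈ k∈ from-K from-unit K≤N k≤N reduct≤N
    where
      from-K : ∀ {m} → m ∈ K ++ X → m ≢ compl k → m ∈ reduce k K ++ X
      from-K m∈ m≢k̄ with ∈-++⁻ K m∈
      ... | inj₁ m∈K = ∈-++⁺ˡ (∈-reduce⁺ k m∈K m≢k̄)
      ... | inj₂ m∈X = ∈-++⁺ʳ (reduce k K) m∈X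
      from-unit : ∀ {m} → m ∈ k ∷ X → m ≢ compl (compl k) → m ∈ reduce k K ++ X
      from-unit (here refl) m≢k = ⊥-elim (m≢k (sym (compl-involutive k)))
      from-unit (there m∈X) _   = ∈-++⁺ʳ (reduce k K) m∈X
      reduct≤N : length (reduce k K ++ X) ≤ N
      reduct≤N = begin
        length (reduce k K ++ X)        ≡⟨ length-++ (reduce k K) ⟩
        length (reduce k K) + length X  ≤⟨ +-monoˡ-≤ (length X) (length-reduce k K) ⟩
        length K + length X             ≡⟨ length-++ K ⟨
        length (K ++ X)                 ≤⟨ K≤N ⟩
        N                               ∎
        where open ≤-Reasoning

  -- A unit step that changes some clause resolves every clause against the unit, and
  -- strictly decreases total ψ.
  propagate : ∀ {Ls} ψ → UP⊥ ψ → (∀ {K} → K ∈ ψ → length (K ++ X) ≤ N) → length ψ ≤ N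
            → Derived ψ Ls → Extension P Ls 4 (total ψ * 338) (clauseF X ∈_)
  propagate ψ (empty []∈ψ) _ _ derived = pure (derived []∈ψ)
  propagate ψ (unit k unit∈ψ rest) short ψ≤N derived with Any.any? (λ K → compl k ∈ᴸ? K) ψ
  ... | no k̄∉ψ rewrite reduce-unused k ψ k̄∉ψ = propagate ψ rest short ψ≤N derived
  ... | yes k̄∈ψ =
    loosen (*-monoˡ-≤ 338 (total-reduce< k ψ k̄∈ψ))
      (for-each ψ (λ K L → clauseF (reduce k K ++ X) ∈ L) (λ _ e → e) ψ≤N
         (λ e {K} K∈ψ → emit id (resolve-unit k K (e (derived K∈ψ)) (e (derived unit∈ψ)) (short K∈ψ) (short unit∈ψ)))
       >>= λ _ derived′ → propagate (map (reduce k) ψ) rest short′ (subst (_≤ N) (sym (length-map _ ψ)) ψ≤N)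
                            (λ K∈ → reduct-derived K∈ derived′))
    where
      reduct-derived : ∀ {L K} → K ∈ map (reduce k) ψ → (∀ {K} → K ∈ ψ → clauseF (reduce k K ++ X) ∈ L) → clauseF (K ++ X) ∈ L
      reduct-derived K∈ d with ∈-map⁻ (reduce k) K∈
      ... | K′ , K′∈ψ , refl = d K′∈ψ
      short′ : ∀ {K} → K ∈ map (reduce k) ψ → length (K ++ X) ≤ N
      short′ K∈ with ∈-map⁻ (reduce k) K∈
      ... | K′ , K′∈ψ , refl = ≤-trans (≤-reflexive (length-++ (reduce k K′)))
                                 (≤-trans (+-monoˡ-≤ (length X) (length-reduce k K′))
                                   (≤-trans (≤-reflexive (sym (length-++ K′))) (short K′∈ψ)))

  clause-∨-X : ∀ {Γ K} → K ∈ φ ++ negUnits X → length (K ++ X) ≤ N → Γ ⊢⟨ 2 , 389 ⟩ clauseF (K ++ X)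
  clause-∨-X {K = K} K∈ K++X≤N with ∈-++⁻ φ K∈
  ... | inj₁ K∈φ = weaken (≤-compute _) (mpᵇ (closed (clause K∈φ)) (⋁-monoᵇ K (K ++ X) (λ h → ∈-++⁺ˡ h) K≤N K++X≤N))
    where
      K≤N : length K ≤ N
      K≤N = ≤-trans (≤-trans (m≤m+n _ _) (≤-reflexive (sym (length-++ K)))) K++X≤N
  ... | inj₂ K∈units with ∈-map⁻ _ K∈units
  ... | x , x∈X , refl = raise (s≤s z≤n) (mpᵇ (lit-excluded-middleᵇ x) cases)
    where
      cases : _ ⊢⟨ 1 , 331 ⟩ litF x ∨' litF (compl x) ⇒ clauseF (compl x ∷ X)
      cases = ∨-elimᵇ (⋁-introᵇ (there x∈X) K++X≤N) (⋁-introᵇ {K = compl x ∷ X} (here refl) K++X≤N)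

  derive-by-propagation : ∀ {Ls} → UP⊥ (φ ++ negUnits X)
                        → (∀ {K} → K ∈ φ ++ negUnits X → length (K ++ X) ≤ N)
                        → length (φ ++ negUnits X) ≤ N → total (φ ++ negUnits X) ≤ N
                        → Extension P Ls 5 727 (clauseF X ∈_)
  derive-by-propagation {Ls} refutation short ψ≤N total≤N = initialise >>= λ _ → finish
    where
      ψ = φ ++ negUnits X
      initialise : Extension P Ls 5 389 (Derived ψ)
      initialise = lift (≤-compute _) (for-each ψ (λ K L → clauseF (K ++ X) ∈ L) (λ _ e → e) ψ≤N
                                                (λ _ K∈ → emit {Γ = []} (λ ()) (clause-∨-X K∈ (short K∈))))
      finish : ∀ {L} → Derived ψ L → Extension P L 5 338 (clauseF X ∈_)
      finish derived = absorb total≤N (propagate ψ refutation short ψ≤N derived)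

-- The extension variables

label : ℕ → List Clause → List (Clause × ℕ)
label n []       = []
label n (D ∷ Ds) = (D , n) ∷ label (suc n) Ds

∈-label⁻ : ∀ {n D o} Ds → (D , o) ∈ label n Ds → D ∈ Ds × n ≤ o × o < n + length Ds
∈-label⁻ {n} (D ∷ Ds) (here refl) = here refl , ≤-refl , m<m+n n (s≤s z≤n)
∈-label⁻ {n} (D ∷ Ds) (there h) with ∈-label⁻ Ds h
... | D∈ , n<o , o< = there D∈ , <⇒≤ n<o , ≤-trans o< (≤-reflexive (sym (+-suc n (length Ds))))

∈-label⁺ : ∀ {n D} Ds → D ∈ Ds → ∃ λ o → (D , o) ∈ label n Ds
∈-label⁺ (D ∷ Ds) (here refl) = _ , here refl
∈-label⁺ (D ∷ Ds) (there h)   = map₂ there (∈-label⁺ Ds h)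

length-label : ∀ n Ds → length (label n Ds) ≡ length Ds
length-label n []       = refl
length-label n (D ∷ Ds) = cong suc (length-label (suc n) Ds)

module Definitions (Φ : DQBF) (sf : SForm Φ) (l : Lit) (l∈E : var l ∈ E (prefix Φ)) where
  open SForm sf

  P₀ : Prefix
  P₀ = prefix Φ

  φ : CNF
  φ = matrix Φ

  old : List ℕ
  old = U P₀ ++ E P₀ ++ matrixVars φ

  fresh₀ : ℕ
  fresh₀ = suc (max 0 old)

  old<fresh₀ : ∀ {x} → x ∈ old → x < fresh₀
  old<fresh₀ x∈ = s≤s (All.lookup (xs≤max 0 old) x∈)

  U<fresh₀ : ∀ {x} → x ∈ U P₀ → x < fresh₀
  U<fresh₀ = old<fresh₀ ∘ ∈-++⁺ˡ

  E<fresh₀ : ∀ {x} → x ∈ E P₀ → x < fresh₀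
  E<fresh₀ = old<fresh₀ ∘ ∈-++⁺ʳ (U P₀) ∘ ∈-++⁺ˡ

  matrix<fresh₀ : ∀ {x} → x ∈ matrixVars φ → x < fresh₀
  matrix<fresh₀ = old<fresh₀ ∘ ∈-++⁺ʳ (U P₀) ∘ ∈-++⁺ʳ (E P₀)

  -- The variables introduced before next are those in [fresh₀, next).
  New : ℕ → ℕ → Set
  New next z = fresh₀ ≤ z × z < next

  new-step : ∀ {next z} → New (suc next) z → z ≡ next ⊎ New next z
  new-step (fresh₀≤z , z<1+next) with m<1+n⇒m<n∨m≡n z<1+next
  ... | inj₁ z<next = inj₂ (fresh₀≤z , z<next)
  ... | inj₂ z≡next = inj₁ z≡next

  record Invariant (next : ℕ) (P : Prefix) (L : List Form) : Set where
    field
      started      : fresh₀ ≤ next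
      U-unchanged  : U P ≡ U P₀
      E-old        : E P₀ ⊆ E P
      E-old-or-new : ∀ {z} → z ∈ E P → z ∈ E P₀ ⊎ New next z
      E-new        : ∀ {z} → New next z → z ∈ E P
      dep-old      : ∀ {z} → z < fresh₀ → dep P z ≡ dep P₀ z
      dep-new      : ∀ {z} → New next z → dep P z ⊆ dep P₀ (var l)
      lines-below  : ∀ {F x} → F ∈ L → Occ x F → x < next

  open Invariant

  no-new : ∀ {z} → ¬ New fresh₀ z
  no-new (fresh₀≤z , z<fresh₀) = <⇒≱ z<fresh₀ fresh₀≤z

  invariant₀ : Invariant fresh₀ P₀ []
  invariant₀ = record
    { started = ≤-refl ; U-unchanged = refl ; E-old = id ; E-old-or-new = inj₁
    ; E-new = ⊥-elim ∘ no-new ; dep-old = λ _ → refl ; dep-new = ⊥-elim ∘ no-new ; lines-below = λ () }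

  fresh : ∀ {next P L} → Invariant next P L → Fresh φ ⟨ P , L ⟩ next
  fresh {next} {P} inv = ∉U , ∉E , (λ next∈ → <⇒≱ (matrix<fresh₀ next∈) (started inv))
                       , λ F∈L o → <-irrefl refl (lines-below inv F∈L o)
    where
      ∉U : next ∉ U P
      ∉U next∈ rewrite U-unchanged inv = <⇒≱ (U<fresh₀ next∈) (started inv)
      ∉E : next ∉ E P
      ∉E next∈ with E-old-or-new inv next∈
      ... | inj₁ next∈E₀   = <⇒≱ (E<fresh₀ next∈E₀) (started inv)
      ... | inj₂ (_ , n<n) = <-irrefl refl n<n

  depOf-old : ∀ {next P L} → Invariant next P L → ∀ {z} → z < fresh₀ → depOf P z ≡ depOf P₀ z
  depOf-old inv z<fresh₀ rewrite U-unchanged inv | dep-old inv z<fresh₀ = refl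

  depOf-new : ∀ {next P L} → Invariant next P L → ∀ {z} → New next z → depOf P z ⊆ dep P₀ (var l)
  depOf-new {P = P} inv {z} new rewrite depOf-∉U P (λ z∈U → <⇒≱ (U<fresh₀ (subst (z ∈_) (U-unchanged inv) z∈U)) (proj₁ new)) =
    dep-new inv new

  define : ∀ {next P L} (Y : List Lit) (G : Form) → Invariant next P L
         → (∀ {x} → Occ x G → x < next) → (∀ {y} → y ∈ Y → depOf P (var y) ⊆ dep P₀ (var l))
         → Invariant (suc next) (addE P next (indDep P [] Y)) (L ++ definition next G ∷ [])
  define {next} {P} {L} Y G inv G-below Y-deps = record
    { started      = m≤n⇒m≤1+n (started inv)
    ; U-unchanged  = U-unchanged inv
    ; E-old        = ∈-++⁺ˡ ∘ E-old inv
    ; E-old-or-new = old-or-new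
    ; E-new        = new
    ; dep-old      = λ z<fresh₀ → trans (dep-addE-≢ P (λ { refl → <⇒≱ z<fresh₀ (started inv) })) (dep-old inv z<fresh₀)
    ; dep-new      = deps
    ; lines-below  = below }
    where
      widen : ∀ {z} → New next z → New (suc next) z
      widen (fresh₀≤z , z<next) = fresh₀≤z , m≤n⇒m≤1+n z<next
      old-or-new : ∀ {z} → z ∈ E P ++ next ∷ [] → z ∈ E P₀ ⊎ New (suc next) z
      old-or-new z∈ with ∈-++⁻ (E P) z∈
      ... | inj₁ z∈E = Data.Sum.map₂ widen (E-old-or-new inv z∈E)
      ... | inj₂ (here refl) = inj₂ (started inv , ≤-refl)
      new : ∀ {z} → New (suc next) z → z ∈ E P ++ next ∷ []
      new z-new with new-step z-new
      ... | inj₁ refl = ∈-++⁺ʳ (E P) (here refl)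
      ... | inj₂ z-new′ = ∈-++⁺ˡ (E-new inv z-new′)
      deps : ∀ {z} → New (suc next) z → dep (addE P next (indDep P [] Y)) z ⊆ dep P₀ (var l)
      deps z-new x∈ with new-step z-new
      ... | inj₁ refl with ∈-indDep⁻ P Y (subst (_ ∈_) (dep-addE-≡ P next _) x∈)
      ...   | y∈Y = let y , y∈ , x∈y = find y∈Y in Y-deps y∈ x∈y
      deps z-new x∈ | inj₂ z-new′ = dep-new inv z-new′ (subst (_ ∈_) (dep-addE-≢ P (λ { refl → <-irrefl refl (proj₂ z-new′) })) x∈)
      below : ∀ {F x} → F ∈ L ++ definition next G ∷ [] → Occ x F → x < suc next
      below F∈ o with ∈-++⁻ L F∈
      ... | inj₁ F∈L = m≤n⇒m≤1+n (lines-below inv F∈L o)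
      ... | inj₂ (here refl) with occurs-definition o
      ...   | inj₁ refl = ≤-refl
      ...   | inj₂ o′   = m≤n⇒m≤1+n (G-below o′)

  record Admissible (next : ℕ) (P : Prefix) (Y : List Lit) : Set where
    field
      declared : ∀ {y} → y ∈ Y → var y ∈ U P ++ E P
      below    : ∀ {y} → y ∈ Y → var y < next
      deps     : ∀ {y} → y ∈ Y → depOf P (var y) ⊆ dep P₀ (var l)

  module _ {next P L} (inv : Invariant next P L) {Y : List Lit} (adm : Admissible next P Y) where
    open Admissible adm

    private
      P′ : Prefix
      P′ = addE P next (indDep P [] Y)

      below-map : ∀ {x} → x ∈ map var Y → x < next
      below-map x∈ with ∈-map⁻ var x∈
      ... | y , y∈Y , refl = below y∈Y

    extend-∨ : Step φ ⟨ P , L ⟩ ⟨ P′ , L ++ definition next (clauseF Y) ∷ [] ⟩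
             × Invariant (suc next) P′ (L ++ definition next (clauseF Y) ∷ [])
    extend-∨ = indExt∨ [] Y next [] (All.tabulate declared) (fresh inv)
             , define Y (clauseF Y) inv (below-map ∘ occurs-clauseF Y) deps

    extend-∧ : Step φ ⟨ P , L ⟩ ⟨ P′ , L ++ definition next (conjF Y) ∷ [] ⟩
             × Invariant (suc next) P′ (L ++ definition next (conjF Y) ∷ [])
    extend-∧ = indExt∧ [] Y next [] (All.tabulate declared) (fresh inv)
             , define Y (conjF Y) inv (below-map ∘ occurs-conjF Y) deps

  var∈matrixVars : ∀ {D y} → D ∈ φ → y ∈ D → var y ∈ matrixVars φ
  var∈matrixVars D∈φ y∈D = ∈-concatMap⁺ (map var) (Any.map (λ { refl → ∈-map⁺ var y∈D }) D∈φ)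

  outer-admissible : ∀ {next P L} D → D ∈ φ → Invariant next P L → Admissible next P (outer P₀ l D)
  outer-admissible {P = P} D D∈φ inv = record
    { declared = λ y∈ → declared (closed (var∈matrixVars D∈φ (y∈D y∈)))
    ; below    = λ y∈ → <-≤-trans (var<fresh₀ y∈) (started inv)
    ; deps     = λ y∈ → subst (_⊆ dep P₀ (var l)) (sym (depOf-old inv (var<fresh₀ y∈))) (proj₁ (proj₂ (∈-outer⁻ P₀ l disjoint l∈E D y∈))) }
    where
      y∈D : ∀ {y} → y ∈ outer P₀ l D → y ∈ D
      y∈D y∈ = proj₁ (∈-outer⁻ P₀ l disjoint l∈E D y∈)
      var<fresh₀ : ∀ {y} → y ∈ outer P₀ l D → var y < fresh₀
      var<fresh₀ y∈ = matrix<fresh₀ (var∈matrixVars D∈φ (y∈D y∈))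
      declared : ∀ {x} → x ∈ U P₀ ++ E P₀ → x ∈ U P ++ E P
      declared x∈ with ∈-++⁻ (U P₀) x∈
      ... | inj₁ x∈U = ∈-++⁺ˡ (subst (_ ∈_) (sym (U-unchanged inv)) x∈U)
      ... | inj₂ x∈E = ∈-++⁺ʳ (U P) (E-old inv x∈E)

  outer-definition : Clause × ℕ → Form
  outer-definition (D , o) = definition o (clauseF (outer P₀ l D))

  record Defined (next : ℕ) (Ds : List Clause) (P : Prefix) (L : List Form) : Set where
    constructor defined
    field
      {prefix′}  : Prefix
      {lines′}   : List Form
      derivation : Deriv φ (length Ds) ⟨ P , L ⟩ ⟨ prefix′ , lines′ ⟩
      invariant  : Invariant (next + length Ds) prefix′ lines′
      in-lines   : ∀ {p} → p ∈ label next Ds → outer-definition p ∈ lines′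

  define-outers : ∀ {next P L} Ds → (∀ {D} → D ∈ Ds → D ∈ φ) → Invariant next P L → Defined next Ds P L
  define-outers {next} {P} {L} [] _ inv = defined done (subst (λ n → Invariant n P L) (sym (+-identityʳ next)) inv) (λ ())
  define-outers {next} {L = L} (D ∷ Ds) Ds⊆φ inv with extend-∨ inv (outer-admissible D (Ds⊆φ (here refl)) inv)
  ... | first , inv′ with define-outers Ds (Ds⊆φ ∘ there) inv′
  ... | defined {P′} {L′} rest inv″ in-lines =
    defined (step first rest) (subst (λ n → Invariant n P′ L′) (sym (+-suc next (length Ds))) inv″) λ
      { (here refl) → lines-grow rest (∈-++⁺ʳ L (here refl)) ; (there p∈) → in-lines p∈ }

  Dₗ : List Clause
  Dₗ = filter (λ D → compl l ∈ᴸ? D) φ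

  -- o_D for the i-th clause D of Dₗ is fresh₀ + i; a and l′ come next.
  labels : List (Clause × ℕ)
  labels = label fresh₀ Dₗ

  os : List ℕ
  os = map proj₂ labels

  labelled : ∀ {D o} → (D , o) ∈ labels → D ∈ φ × compl l ∈ D
  labelled p∈ = ∈-filter⁻ (λ D → compl l ∈ᴸ? D) (proj₁ (∈-label⁻ Dₗ p∈))

  label-of : ∀ {D} → D ∈ φ → compl l ∈ D → ∃ λ o → (D , o) ∈ labels
  label-of D∈φ l̄∈D = ∈-label⁺ Dₗ (∈-filter⁺ (λ D → compl l ∈ᴸ? D) D∈φ l̄∈D)

  a : ℕ
  a = fresh₀ + length Dₗ

  l′ : ℕ
  l′ = suc a

  fresh₀≤a : fresh₀ ≤ a
  fresh₀≤a = m≤m+n fresh₀ (length Dₗ)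

  l′-fresh : l′ ∉ U P₀ ++ E P₀
  l′-fresh l′∈ = <⇒≱ ([ U<fresh₀ , E<fresh₀ ]′ (∈-++⁻ (U P₀) l′∈)) (m≤n⇒m≤1+n fresh₀≤a)

  record Extended : Set where
    field
      prefix′       : Prefix
      lines′        : List Form
      derivation    : Deriv φ (length Dₗ + 2) ⟨ P₀ , [] ⟩ ⟨ prefix′ , lines′ ⟩
      outer-defined : ∀ {p} → p ∈ labels → outer-definition p ∈ lines′
      a-defined     : definition a (conjF (map pos os)) ∈ lines′
      l′-defined    : definition l′ (clauseF (l ∷ pos a ∷ [])) ∈ lines′
      l′∈E          : l′ ∈ E prefix′
      l′-dep        : depOf prefix′ l′ ⊆ dep P₀ (var l)

  labels-admissible : ∀ {P L} → Invariant a P L → Admissible a P (map pos os)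
  labels-admissible {P} inv = record
    { declared = λ y∈ → ∈-++⁺ʳ (U P) (E-new inv (new y∈))
    ; below    = λ y∈ → proj₂ (new y∈)
    ; deps     = λ y∈ → depOf-new inv (new y∈) }
    where
      new : ∀ {y} → y ∈ map pos os → New a (var y)
      new y∈ with ∈-map⁻ pos y∈
      ... | o , o∈ , refl with ∈-map⁻ proj₂ o∈
      ...   | (D , o) , p∈ , refl = proj₂ (∈-label⁻ Dₗ p∈)

  l′-admissible : ∀ {P L} → Invariant (suc a) P L → Admissible (suc a) P (l ∷ pos a ∷ [])
  l′-admissible {P} inv = record { declared = declared ; below = below ; deps = deps }
    where
      a-new : New (suc a) a
      a-new = fresh₀≤a , ≤-refl
      declared : ∀ {y} → y ∈ l ∷ pos a ∷ [] → var y ∈ U P ++ E P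
      declared (here refl)         = ∈-++⁺ʳ (U P) (E-old inv l∈E)
      declared (there (here refl)) = ∈-++⁺ʳ (U P) (E-new inv a-new)
      below : ∀ {y} → y ∈ l ∷ pos a ∷ [] → var y < suc a
      below (here refl)         = <-≤-trans (E<fresh₀ l∈E) (started inv)
      below (there (here refl)) = ≤-refl
      deps : ∀ {y} → y ∈ l ∷ pos a ∷ [] → depOf P (var y) ⊆ dep P₀ (var l)
      deps (here refl) rewrite depOf-old inv (E<fresh₀ l∈E) | depOf-∉U P₀ (λ l∈U → disjoint l∈U l∈E) = id
      deps (there (here refl)) = depOf-new inv a-new

  extended : Extended
  extended with define-outers Dₗ (proj₁ ∘ ∈-filter⁻ _) invariant₀
  ... | defined {P₁} {L₁} d₁ inv₁ outers with extend-∧ inv₁ (labels-admissible inv₁)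
  ... | step-a , inv₂ with extend-∨ inv₂ (l′-admissible inv₂)
  ... | step-l′ , inv₃ = record
    { derivation    = d₁ ++ᴰ step step-a (step step-l′ done)
    ; outer-defined = lines-grow (step step-a (step step-l′ done)) ∘ outers
    ; a-defined     = lines-grow (step step-l′ done) (∈-++⁺ʳ L₁ (here refl))
    ; l′-defined    = ∈-++⁺ʳ _ (here refl)
    ; l′∈E          = E-new inv₃ l′-new
    ; l′-dep        = depOf-new inv₃ l′-new }
    where
      l′-new : New (suc l′) l′
      l′-new = m≤n⇒m≤1+n fresh₀≤a , ≤-refl

-- The renamed formula

module Renaming (Φ : DQBF) (sf : SForm Φ) (l : Lit) (l∈E : var l ∈ E (prefix Φ)) (C : Clause) (l∈C : l ∈ C)
                (rup : ∀ {D} → D ∈ matrix Φ → compl l ∈ D →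
                       UP⊥ (matrix Φ ++ negUnits C ++ negUnits (outer (prefix Φ) l D) ++ negUnits (l ∷ [])))
                (s : ℕ) (clause≤s : ∀ {K} → K ∈ matrix Φ → length K ≤ s) (φ≤s : length (matrix Φ) ≤ s)
                (total≤s : total (matrix Φ) ≤ s) (C≤2s : length C ≤ 2 * s) where

  open Definitions Φ sf l l∈E
  open Extended extended

  -- N bounds the lengths of the clauses of φ, of φ, of C′ and of X D below.
  N : ℕ
  N = 4 * suc s

  open Derivations φ N

  rename : Clause → Clause
  rename = renameC l l′

  s≤N : s ≤ N
  s≤N = ≤-trans (n≤1+n s) (m≤n*m (suc s) 4)

  2≤N : 2 ≤ N
  2≤N = ≤-trans (≤-compute _) (*-monoʳ-≤ 4 (s≤s (z≤n {s})))

  length-rename : ∀ K → length (rename K) ≡ length K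
  length-rename = length-map (renameLit l l′)

  clause≤N : ∀ {K} → K ∈ φ → length K ≤ N
  clause≤N K∈φ = ≤-trans (clause≤s K∈φ) s≤N

  renamed≤N : ∀ {K} → K ∈ φ → length (rename K) ≤ N
  renamed≤N {K} K∈φ = subst (_≤ N) (sym (length-rename K)) (clause≤N K∈φ)

  C′≤N : length (rename C) ≤ N
  C′≤N = subst (_≤ N) (sym (length-rename C)) (≤-trans C≤2s (≤-trans (m≤m+n (2 * s) (2 * s + 4)) (≤-reflexive (lemma s))))
    where
      lemma : ∀ s → 2 * s + (2 * s + 4) ≡ 4 * suc s
      lemma = solve-∀

  os≤N : length os ≤ N
  os≤N = ≤-trans (≤-reflexive (trans (length-map proj₂ labels) (length-label fresh₀ Dₗ)))
                 (≤-trans (length-filter _ φ) (≤-trans φ≤s s≤N))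

  outer≤s : ∀ {D} → D ∈ φ → length (outer P₀ l D) ≤ s
  outer≤s {D} D∈φ = ≤-trans (≤-reflexive (cong length (filterB≡filter _ (T? ∘ _) (λ _ → refl) D)))
                            (≤-trans (length-filter _ D) (clause≤s D∈φ))

  outer≤N : ∀ {D} → D ∈ φ → length (outer P₀ l D) ≤ N
  outer≤N D∈φ = ≤-trans (outer≤s D∈φ) s≤N

  -- rup says that X D follows from φ by reverse unit propagation.
  X : Clause → Clause
  X D = C ++ outer P₀ l D ++ l ∷ []

  X≤3s+1 : ∀ {D} → D ∈ φ → length (X D) ≤ 3 * s + 1
  X≤3s+1 {D} D∈φ = begin
    length (X D)                            ≡⟨ length-++ C ⟩
    length C + length (outer P₀ l D ++ l ∷ []) ≡⟨ cong (length C +_) (length-++ (outer P₀ l D)) ⟩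
    length C + (length (outer P₀ l D) + 1)  ≤⟨ +-mono-≤ C≤2s (+-monoˡ-≤ 1 (outer≤s D∈φ)) ⟩
    2 * s + (s + 1)                         ≡⟨ lemma s ⟩
    3 * s + 1                               ∎
    where
      open ≤-Reasoning
      lemma : ∀ s → 2 * s + (s + 1) ≡ 3 * s + 1
      lemma = solve-∀

  fits-N : ∀ {m n} → m ≤ suc s → n ≤ 3 * s + 1 → m + n ≤ N
  fits-N {m} {n} m≤ n≤ = ≤-trans (+-mono-≤ m≤ n≤) (≤-trans (m≤m+n _ 2) (≤-reflexive (lemma s)))
    where
      lemma : ∀ s → suc s + (3 * s + 1) + 2 ≡ 4 * suc s
      lemma = solve-∀

  X≤N : ∀ {D} → D ∈ φ → length (X D) ≤ N
  X≤N D∈φ = fits-N z≤n (X≤3s+1 D∈φ)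

  l′∈rename : ∀ {K} → l ∈ K → pos l′ ∈ rename K
  l′∈rename {K} l∈K = subst (_∈ rename K) (rename-self l l′) (∈-rename⁺ l l′ l∈K)

  ¬l′∈rename : ∀ {K} → compl l ∈ K → neg l′ ∈ rename K
  ¬l′∈rename {K} l̄∈K = subst (_∈ rename K) (rename-compl l l′) (∈-rename⁺ l l′ l̄∈K)

  unrenamed : ∀ {m K} → m ∈ K → var m ≢ var l → m ∈ rename K
  unrenamed {K = K} m∈K m≢l = subst (_∈ rename K) (rename-other l l′ m≢l) (∈-rename⁺ l l′ m∈K)

  module _ {Γ : List Form} (lines′⊆Γ : lines′ ⊆ˡ Γ) where

    l⇒l′ : Γ ⊢⟨ 1 , 331 ⟩ litF l ⇒ v l′
    l⇒l′ = ⋁-introᵇ {K = l ∷ pos a ∷ []} (here refl) 2≤N ⨾ definition⇐ᵇ (lines′⊆Γ l′-defined)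

    a⇒outer : ∀ {D o} → (D , o) ∈ labels → Γ ⊢⟨ 1 , 498 ⟩ v a ⇒ clauseF (outer P₀ l D)
    a⇒outer p∈ = definition⇒ᵇ (lines′⊆Γ a-defined)
               ⨾ ⋀-elimᵇ (∈-map⁺ pos (∈-map⁺ proj₂ p∈)) (subst (_≤ N) (sym (length-map pos os)) os≤N)
               ⨾ definition⇒ᵇ (lines′⊆Γ (outer-defined p∈))

    l̄⇒renamed : ∀ {D} → D ∈ φ → compl l ∈ D → Γ ⊢⟨ 2 , 1657 ⟩ litF (compl l) ⇒ clauseF (rename D)
    l̄⇒renamed {D} D∈φ l̄∈D = mpᵇ (closed (excluded-middle (v l′))) (∨-elimᵇ if-l′ if-¬l′)
      where
        outer⊆ : outer P₀ l D ⊆ᶜ rename D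
        outer⊆ y∈ = let y∈D , _ , y≢l = ∈-outer⁻ P₀ l (SForm.disjoint sf) l∈E D y∈ in unrenamed y∈D y≢l
        if-a : Γ ⊢⟨ 2 , 993 ⟩ v a ⇒ litF (compl l) ⇒ clauseF (rename D)
        if-a = weaken-premise _ (raise (s≤s z≤n) (a⇒outer (proj₂ (label-of D∈φ l̄∈D)))
                                 ⨾ ⋁-monoᵇ (outer P₀ l D) (rename D) outer⊆ (outer≤N D∈φ) (renamed≤N D∈φ))
        if-l′ : Γ ⊢⟨ 2 , 1274 ⟩ v l′ ⇒ litF (compl l) ⇒ clauseF (rename D)
        if-l′ = definition⇒ᵇ (lines′⊆Γ l′-defined) ⨾ ∨-elimᵇ (lit-explosionᵇ l _) (∨-elimᵇ if-a (closed (axiom (ax12 _))))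
        if-¬l′ : Γ ⊢⟨ 2 , 328 ⟩ ¬' v l′ ⇒ litF (compl l) ⇒ clauseF (rename D)
        if-¬l′ = raise (s≤s z≤n) (weaken-premise _ (⋁-introᵇ (¬l′∈rename l̄∈D) (renamed≤N D∈φ)))

    renamed-clause : ∀ {D} → D ∈ φ → Γ ⊢⟨ 3 , 1663 ⟩ clauseF (rename D)
    renamed-clause {D} D∈φ = mpᵇ (closed (clause D∈φ)) (⋁-elimᵇ D (clause≤N D∈φ) literal)
      where
        literal : ∀ {m} → m ∈ D → Γ ⊢⟨ 2 , 1657 ⟩ litF m ⇒ clauseF (rename D)
        literal {m} m∈D with var m ≟ var l
        ... | no m≢l = weaken (≤-compute _) (raise (s≤s z≤n) (⋁-introᵇ (unrenamed m∈D m≢l) (renamed≤N D∈φ)))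
        ... | yes m≡l with same-var m l m≡l
        ...   | inj₁ refl = weaken (≤-compute _) (raise (s≤s z≤n) (l⇒l′ ⨾ ⋁-introᵇ (l′∈rename m∈D) (renamed≤N D∈φ)))
        ...   | inj₂ refl = l̄⇒renamed D∈φ m∈D

    C′-or-label : ∀ {D o} → (D , o) ∈ labels → clauseF (X D) ∈ Γ → compl l ∉ C
                → Γ ⊢⟨ 2 , 827 ⟩ clauseF (rename C) ∨' v o
    C′-or-label {D} {o} p∈ X∈Γ l̄∉C = mpᵇ (assumption X∈Γ) (⋁-elimᵇ (X D) (X≤N D∈φ) literal)
      where
        O = outer P₀ l D
        D∈φ : D ∈ φ
        D∈φ = proj₁ (labelled p∈)
        literal : ∀ {m} → m ∈ X D → Γ ⊢⟨ 1 , 822 ⟩ litF m ⇒ clauseF (rename C) ∨' v o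
        literal {m} m∈X with m ≟ᴸ l
        ... | yes refl = l⇒l′ ⨾ ⋁-introᵇ (l′∈rename l∈C) C′≤N ⨾ closed (axiom (ax6 _ _))
        ... | no m≢l with m ∈ᴸ? C
        ...   | yes m∈C = weaken (≤-compute _) (⋁-introᵇ (unrenamed m∈C var≢) C′≤N ⨾ closed (axiom (ax6 _ _)))
          where
            var≢ : var m ≢ var l
            var≢ m≡l with same-var m l m≡l
            ... | inj₁ m≡l′ = m≢l m≡l′
            ... | inj₂ refl = l̄∉C m∈C
        ...   | no m∉C = weaken (≤-compute _) (⋁-introᵇ m∈O (outer≤N D∈φ) ⨾ definition⇐ᵇ (lines′⊆Γ (outer-defined p∈)) ⨾ closed (axiom (ax7 _ _)))
          where
            m∈O : m ∈ O
            m∈O with ∈-++⁻ C m∈X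
            ... | inj₁ m∈C = ⊥-elim (m∉C m∈C)
            ... | inj₂ m∈O++l with ∈-++⁻ O m∈O++l
            ...   | inj₁ m∈O       = m∈O
            ...   | inj₂ (here m≡l) = ⊥-elim (m≢l m≡l)

    renamed-C-from-labels : (∀ {o} → o ∈ os → clauseF (rename C) ∨' v o ∈ Γ) → Γ ⊢⟨ 1 , 1702 ⟩ clauseF (rename C)
    renamed-C-from-labels C′∨o∈Γ = mpᵇ (∨-⋀-introᵇ _ os os≤N C′∨o∈Γ) (∨-elimᵇ (closed (⇒-refl _)) a⇒C′)
      where
        a⇒C′ : Γ ⊢⟨ 1 , 825 ⟩ conjF (map pos os) ⇒ clauseF (rename C)
        a⇒C′ = definition⇐ᵇ (lines′⊆Γ a-defined) ⨾ ⋁-introᵇ {K = l ∷ pos a ∷ []} (there (here refl)) 2≤N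
             ⨾ definition⇐ᵇ (lines′⊆Γ l′-defined) ⨾ ⋁-introᵇ (l′∈rename l∈C) C′≤N

    renamed-C-tautology : compl l ∈ C → Γ ⊢⟨ 1 , 383 ⟩ clauseF (rename C)
    renamed-C-tautology l̄∈C = mpᵇ (closed (excluded-middle (v l′)))
                                  (∨-elimᵇ (⋁-introᵇ (l′∈rename l∈C) C′≤N) (⋁-introᵇ (¬l′∈rename l̄∈C) C′≤N))

  negUnits-X : ∀ D → negUnits (X D) ≡ negUnits C ++ negUnits (outer P₀ l D) ++ negUnits (l ∷ [])
  negUnits-X D = trans (map-++ _ C (outer P₀ l D ++ l ∷ [])) (cong (negUnits C ++_) (map-++ _ (outer P₀ l D) (l ∷ [])))

  derive-X : ∀ {L D o} → (D , o) ∈ labels → Extension prefix′ L 5 727 (clauseF (X D) ∈_)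
  derive-X {D = D} p∈ = derive-by-propagation (subst (λ ψ → UP⊥ (φ ++ ψ)) (sym (negUnits-X D)) (rup D∈φ l̄∈D)) short ψ≤N total≤N
    where
      open UnitPropagation φ N prefix′ (X D)
      D∈φ = proj₁ (labelled p∈)
      l̄∈D = proj₂ (labelled p∈)
      short : ∀ {K} → K ∈ φ ++ negUnits (X D) → length (K ++ X D) ≤ N
      short {K} K∈ with ∈-++⁻ φ K∈
      ... | inj₁ K∈φ = subst (_≤ N) (sym (length-++ K)) (fits-N (≤-trans (clause≤s K∈φ) (n≤1+n s)) (X≤3s+1 D∈φ))
      ... | inj₂ K∈units with ∈-map⁻ _ K∈units
      ...   | x , _ , refl = fits-N (s≤s z≤n) (X≤3s+1 D∈φ)
      ψ≤N : length (φ ++ negUnits (X D)) ≤ N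
      ψ≤N = subst (_≤ N) (sym (trans (length-++ φ) (cong (length φ +_) (length-map _ (X D)))))
                  (fits-N (≤-trans φ≤s (n≤1+n s)) (X≤3s+1 D∈φ))
      total≤N : total (φ ++ negUnits (X D)) ≤ N
      total≤N = subst (_≤ N) (sym (trans (total-++ φ _) (cong (total φ +_) (total-negUnits (X D)))))
                      (fits-N (≤-trans total≤s (n≤1+n s)) (X≤3s+1 D∈φ))

  derive-Xs : Extension prefix′ lines′ 6 727 (λ L → ∀ {p} → p ∈ labels → clauseF (X (proj₁ p)) ∈ L)
  derive-Xs = for-each labels (λ p L → clauseF (X (proj₁ p)) ∈ L) (λ _ e → e) labels≤N (λ _ p∈ → derive-X p∈)
    where
      labels≤N : length labels ≤ N
      labels≤N = subst (_≤ N) (length-map proj₂ labels) os≤N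

  derive-C′ : ∀ {L} → lines′ ⊆ˡ L → (∀ {p} → p ∈ labels → clauseF (X (proj₁ p)) ∈ L)
            → Extension prefix′ L 3 2529 (clauseF (rename C) ∈_)
  derive-C′ lines′⊆L Xs with compl l ∈ᴸ? C
  ... | yes l̄∈C = loosen (≤-compute _) (lift (≤-compute _) (emit id (renamed-C-tautology lines′⊆L l̄∈C)))
  ... | no l̄∉C =
    for-each labels (λ p L → clauseF (rename C) ∨' v (proj₂ p) ∈ L) (λ _ e → e) labels≤N
      (λ e p∈ → emit id (C′-or-label (e ∘ lines′⊆L) p∈ (e (Xs p∈)) l̄∉C))
    >>= λ e C′∨o∈ → lift (≤-compute _) (emit id (renamed-C-from-labels (e ∘ lines′⊆L) (λ o∈ → by-label C′∨o∈ o∈)))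
    where
      labels≤N : length labels ≤ N
      labels≤N = subst (_≤ N) (length-map proj₂ labels) os≤N
      by-label : ∀ {L o} → (∀ {p} → p ∈ labels → clauseF (rename C) ∨' v (proj₂ p) ∈ L) → o ∈ os → clauseF (rename C) ∨' v o ∈ L
      by-label C′∨o∈ o∈ with ∈-map⁻ proj₂ o∈
      ... | p , p∈ , refl = C′∨o∈ p∈

  derive-renamed-φ : ∀ {L} → lines′ ⊆ˡ L → Extension prefix′ L 4 1663 (λ L′ → ∀ {D} → D ∈ φ → clauseF (rename D) ∈ L′)
  derive-renamed-φ lines′⊆L = for-each φ (λ D L → clauseF (rename D) ∈ L) (λ _ e → e) (≤-trans φ≤s s≤N)
                                (λ e D∈φ → emit id (renamed-clause (e ∘ lines′⊆L) D∈φ))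

  derive-renamed : Extension prefix′ lines′ 6 4919 (λ L → All (λ D → clauseF (rename D) ∈ L) (C ∷ φ))
  derive-renamed =
    derive-Xs >>= λ e Xs →
    lift (≤-compute _) (derive-C′ e Xs) >>= λ e′ C′∈ →
    lift (≤-compute _) (map-result (λ e″ D′s → e″ C′∈ ∷ All.tabulate (λ {D} → D′s {D})) (derive-renamed-φ (e′ ∘ e)))

literals : List ℕ → Clause
literals V = map pos V ++ map neg V

∈-literals : ∀ {V} k → var k ∈ V → k ∈ literals V
∈-literals {V} (pos x) x∈V = ∈-++⁺ˡ (∈-map⁺ pos x∈V)
∈-literals {V} (neg x) x∈V = ∈-++⁺ʳ (map pos V) (∈-map⁺ neg x∈V)

length-literals : ∀ V → length (literals V) ≡ length V + length V
length-literals V = trans (length-++ (map pos V)) (cong₂ _+_ (length-map pos V) (length-map neg V))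

matrix-size : CNF → ℕ
matrix-size φ = sum (map (λ c → suc (length c)) φ)

length≤matrix-size : ∀ φ → length φ ≤ matrix-size φ
length≤matrix-size []      = z≤n
length≤matrix-size (c ∷ φ) = s≤s (≤-trans (length≤matrix-size φ) (m≤n+m _ (length c)))

clause≤matrix-size : ∀ {φ K} → K ∈ φ → length K ≤ matrix-size φ
clause≤matrix-size {c ∷ φ} (here refl) = ≤-trans (n≤1+n _) (m≤m+n (suc (length c)) _)
clause≤matrix-size {c ∷ φ} (there K∈) = ≤-trans (clause≤matrix-size K∈) (m≤n+m _ (suc (length c)))

total≤matrix-size : ∀ φ → total φ ≤ matrix-size φ
total≤matrix-size []      = z≤n
total≤matrix-size (c ∷ φ) = m≤n⇒m≤1+n (+-monoʳ-≤ (length c) (total≤matrix-size φ))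

matrix-size≤size : ∀ Φ → matrix-size (matrix Φ) ≤ size Φ
matrix-size≤size Φ = m≤n+m _ _

declared≤size : ∀ Φ → length (U (prefix Φ) ++ E (prefix Φ)) ≤ size Φ
declared≤size Φ = ≤-trans (≤-reflexive (length-++ (U (prefix Φ)))) (≤-trans (m≤m+n _ _) (m≤m+n _ _))

*-^-distrib : ∀ m n k → (m * n) ^ k ≡ m ^ k * n ^ k
*-^-distrib m n zero    = refl
*-^-distrib m n (suc k) = trans (cong (m * n *_) (*-^-distrib m n k)) (lemma m n (m ^ k) (n ^ k))
  where
    lemma : ∀ m n a b → m * n * (a * b) ≡ m * a * (n * b)
    lemma = solve-∀

module Main (Φ : DQBF) (sf : SForm Φ) (l : Lit) (C : Clause) (l∈E : var l ∈ E (prefix Φ))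
            (C-declared : All (λ x → var x ∈ (U (prefix Φ) ++ E (prefix Φ))) C) (C-unique : Unique C) (l∈C : l ∈ C)
            (rup : ∀ {D} → D ∈ matrix Φ → compl l ∈ D →
                   UP⊥ (matrix Φ ++ negUnits C ++ negUnits (outer (prefix Φ) l D) ++ negUnits (l ∷ []))) where

  s : ℕ
  s = size Φ

  C≤2s : length C ≤ 2 * s
  C≤2s = begin
    length C                  ≤⟨ length-unique-⊆ C-unique (λ k∈C → ∈-literals _ (All.lookup C-declared k∈C)) ⟩
    length (literals V)       ≡⟨ length-literals V ⟩
    length V + length V       ≤⟨ +-mono-≤ (declared≤size Φ) (≤-trans (declared≤size Φ) (≤-reflexive (sym (+-identityʳ s)))) ⟩
    2 * s                     ∎
    where
      open ≤-Reasoning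
      V = U (prefix Φ) ++ E (prefix Φ)

  open Definitions Φ sf l l∈E public
  open Renaming Φ sf l l∈E C l∈C rup s
    (λ K∈ → ≤-trans (clause≤matrix-size K∈) (matrix-size≤size Φ))
    (≤-trans (length≤matrix-size φ) (matrix-size≤size Φ))
    (≤-trans (total≤matrix-size φ) (matrix-size≤size Φ))
    C≤2s public
  open Derivations φ N public
  open Extended extended public

  steps : ℕ
  steps = length Dₗ + 2 + Extension.steps derive-renamed

  steps≤ : steps ≤ 4922 * 4 ^ 6 * suc s ^ 6
  steps≤ = begin
    length Dₗ + 2 + Extension.steps derive-renamed  ≤⟨ +-mono-≤ setup≤ (Extension.cost derive-renamed) ⟩
    3 * N ^ 6 + 4919 * N ^ 6                        ≡⟨ *-distribʳ-+ (N ^ 6) 3 4919 ⟨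
    4922 * N ^ 6                                    ≡⟨ cong (4922 *_) (*-^-distrib 4 (suc s) 6) ⟩
    4922 * (4 ^ 6 * suc s ^ 6)                      ≡⟨ *-assoc 4922 (4 ^ 6) (suc s ^ 6) ⟨
    4922 * 4 ^ 6 * suc s ^ 6                        ∎
    where
      open ≤-Reasoning
      Dₗ≤N : length Dₗ ≤ N
      Dₗ≤N = ≤-trans (≤-reflexive (sym (trans (length-map proj₂ labels) (length-label fresh₀ Dₗ)))) os≤N
      setup≤ : length Dₗ + 2 ≤ 3 * N ^ 6
      setup≤ = +-mono-≤ (≤-trans Dₗ≤N (m≤m*n N (N ^ 5))) (c≤c*N^ 2 6)

lemma5 : Σ ℕ λ c → Σ ℕ λ k →
  (Φ : DQBF) → SForm Φ →
  (l : Lit) (C : Clause) →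
  var l ∈ E (prefix Φ) →
  All (λ x → var x ∈ (U (prefix Φ) ++ E (prefix Φ))) C →
  Unique C →
  (∀ {D} → D ∈ matrix Φ → ¬ (C ⊆ᶜ D × D ⊆ᶜ C)) →
  l ∈ C →
  (∀ {D} → D ∈ matrix Φ → compl l ∈ D →
     UP⊥ (matrix Φ ++ negUnits C ++ negUnits (outer (prefix Φ) l D) ++ negUnits (l ∷ []))) →
  Σ ℕ λ n → Σ State λ S →
    (n ≤ c * suc (size Φ) ^ k)
    × Deriv (matrix Φ) n (initState Φ) S
    × (Σ ℕ λ l′ →
         (l′ ∉ (U (prefix Φ) ++ E (prefix Φ)))
         × (l′ ∈ E (pre S))
         × (depOf (pre S) l′ ⊆ dep (prefix Φ) (var l))
         × All (λ D → clauseF (renameC l l′ D) ∈ lines S) (C ∷ matrix Φ))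
lemma5 = 4922 * 4 ^ 6 , 6 , λ Φ sf l C l∈E C-declared C-unique _ l∈C rup →
  let open Main Φ sf l C l∈E C-declared C-unique l∈C rup in
  steps , _ , steps≤ , derivation ++ᴰ Extension.derivation derive-renamed
  , l′ , l′-fresh , l′∈E , l′-dep , Extension.result derive-renamed
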